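{- Let $B=(B_1,\dots,B_L)\in\mathcal M(L,n)$. Then $\rho_N(B)\in\mathrm{MLQ}_0(\mu,n)$ for some partition $\mu$, and $\rho_Q(B)$ is a semistandard Young tableau of shape $\mu'$ with content $(|B_1|,\dots,|B_L|)$.
   Context: $\mathcal M(L,n)$ is the set of tuples $B=(B_1,\dots,B_L)$ of subsets of $[n]=\{1,\dots,n\}$, drawn with rows $1,\dots,L$ bottom to top and columns $1,\dots,n$ left to right, a ball at $(r,j)$ iff $j\in B_r$. The column word $\mathrm{cw}(B)$ records the row number of each ball, scanning columns left to right, each column top to bottom. For a word $w$ and $i\ge1$, $\mathrm{Par}_i(w)$ writes "(" for each letter $i+1$ and ")" for each letter $i$ (reading left to right, other letters ignored) and matches parentheses iteratively when an "(" is immediately followed by ")" or separated from it only by matched parentheses; a ball of row $i+1$ is unmatched above if its letter is unmatched in $\mathrm{Par}_i(\mathrm{cw}(B))$. The operator $e_i^\star$ moves all balls of row $i+1$ unmatched above to row $i$ (same column). Operators compose right to left; $e^\star_{[a,b]}=e^\star_ae^\star_{a+1}\cdots e^\star_b$. Collapsing: $\rho_N(B)=e^\star_{[1,L-1]}e^\star_{[1,L-2]}\cdots e^\star_{[1,1]}(B)$. For $0\le k\le L$ let $c^{(k)}_r$ be the number of balls in row $r$ of $e^\star_{[1,k-1]}\cdots e^\star_{[1,1]}(B)$ when $r\le k$ (for $k=1$ this is $B$ itself), and $c^{(k)}_r=0$ when $r>k$ (in particular $c^{(0)}\equiv0$). The recording tableau $\rho_Q(B)$ is the filling (French notation, rows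 numbered from the bottom) whose row $r$ consists of $c^{(k)}_r-c^{(k-1)}_r$ entries $k$ for $k=1,\dots,L$ in increasing order. A multiline queue of shape $\mu$ is an element of $\mathcal M(\mu_1,n)$ whose row $r$ has $\mu'_r$ balls; an element of $\mathcal M(L,n)$ whose row sizes are weakly decreasing from the bottom is regarded as a multiline queue of the shape $\mu$ determined by these sizes (trailing empty rows ignored). Ferrari–Martin labelling: for $r=\mu_1,\dots,2$, unlabelled balls of row $r$ get label $r$; then balls of row $r$, in order of decreasing label and left to right among equal labels, are each paired with the first not yet labelled ball of row $r-1$ weakly to the right, cyclically (from column $n$ to column $1$), which gets the same label; the pairing wraps if it passes from column $n$ to column $1$. $\mathrm{maj}(M)=\sum(\ell-r+1)$ over wrapping pairings, $\ell$ the label and $r$ the starting row. $\mathrm{MLQ}_0(\mu,n)$ is the set of multiline queues of shape $\mu$ on $n$ columns with $\mathrm{maj}=0$. Semistandard tableaux are in French notation: rows weakly increase left to right, columns strictly increase bottom to top. -}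

module Defs where

open import Data.Bool using (Bool; true; false; if_then_else_; _∧_; _∨_; not)
open import Data.Nat using (ℕ; zero; suc; _+_; _∸_; _≤_; _<_; _≡ᵇ_; _<ᵇ_; _≤ᵇ_; pred)
open import Data.List using (List; []; _∷_; map; length; filterᵇ; upTo; downFrom; concatMap; concat; replicate; _++_)
open import Data.Bool.ListAction using (any)
open import Data.Nat.ListAction using (sum)
open import Data.List.Relation.Unary.All using (All)
open import Data.List.Relation.Unary.Linked using (Linked)
open import Data.Maybe using (Maybe; just; nothing; fromMaybe)
open import Data.Product using (_×_; _,_; proj₁; proj₂; ∃)
open import Data.Vec using (Vec; tabulate; toList)
open import Data.Fin using (Fin; toℕ)
open import Relation.Binary.PropositionalEquality using (_≡_)

-- An element of 𝓜(L,n) is a grid  Vec (Vec Bool n) L :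
-- the r-th vector (r = 1..L, stored at index r-1) is row r (bottom to top),
-- its j-th entry (j = 1..n, index j-1) is true iff j ∈ B_r.

Grid : ℕ → ℕ → Set
Grid L n = Vec (Vec Bool n) L

at : {A : Set} → List A → ℕ → Maybe A
at []       _       = nothing
at (x ∷ xs) zero    = just x
at (x ∷ xs) (suc k) = at xs k

one-to : ℕ → List ℕ
one-to k = map suc (upTo k)

-- row r (1-indexed; rows 0 and > L are empty)
rowOf : {L n : ℕ} → Grid L n → ℕ → List Bool
rowOf B zero    = []
rowOf B (suc r) = fromMaybe [] (at (map toList (toList B)) r)

-- is there a ball at (row r, column j)?  (1-indexed, false out of range)
ball : {L n : ℕ} → Grid L n → ℕ → ℕ → Bool
ball B r zero    = false
ball B r (suc j) = fromMaybe false (at (rowOf B r) j)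

-- |B_r|  (0 for r = 0 or r > L)
rowCount : {L n : ℕ} → Grid L n → ℕ → ℕ
rowCount {L} {n} B r = length (filterᵇ (ball B r) (one-to n))

ballCols : {L n : ℕ} → Grid L n → ℕ → List ℕ
ballCols {L} {n} B r = filterᵇ (ball B r) (one-to n)

-- Column word, recorded as the list of balls (row , column) in reading
-- order: columns left to right, each column top to bottom.  The letter
-- of a ball is its row.

colWord : {L n : ℕ} → Grid L n → List (ℕ × ℕ)
colWord {L} {n} B =
  concatMap (λ j → map (λ r → (r , j)) (filterᵇ (λ r → ball B r j) (map suc (downFrom L))))
            (one-to n)

-- Par_i bracketing: letter i+1 is "(", letter i is ")".  Scanning left to
-- right with a stack of pending "(" (recorded by column), a ")" is matched
-- with the nearest pending "(" (all brackets in between being matched).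
-- The stack at the end lists the columns of the unmatched "(" balls.
parScan : ℕ → List ℕ → List (ℕ × ℕ) → List ℕ
parScan i st []             = st
parScan i st ((r , j) ∷ w) =
  if r ≡ᵇ suc i then parScan i (j ∷ st) w
  else if r ≡ᵇ i then parScan i (Data.List.drop 1 st) w
  else parScan i st w

unmatchedAbove : {L n : ℕ} → ℕ → Grid L n → List ℕ
unmatchedAbove i B = parScan i [] (colWord B)

memℕ : ℕ → List ℕ → Bool
memℕ j xs = any (j ≡ᵇ_) xs

e⋆ : {L n : ℕ} → ℕ → Grid L n → Grid L n
e⋆ i B = tabulate λ r → tabulate λ j →
  let R = suc (toℕ r) ; J = suc (toℕ j) ; U = unmatchedAbove i B in
  if R ≡ᵇ suc i then (ball B R J ∧ not (memℕ J U))
  else if R ≡ᵇ i then (ball B R J ∨ memℕ J U)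
  else ball B R J

-- eSeq [a₁,…,a_m] = e⋆_{a₁} ∘ ⋯ ∘ e⋆_{a_m}  (rightmost applied first)
eSeq : {L n : ℕ} → List ℕ → Grid L n → Grid L n
eSeq []       B = B
eSeq (a ∷ as) B = e⋆ a (eSeq as B)

e⋆[1,_] : {L n : ℕ} → ℕ → Grid L n → Grid L n
e⋆[1, k ] = eSeq (one-to k)

-- stage k B = e⋆_{[1,k-1]} ⋯ e⋆_{[1,1]} (B)   (stage 0 = stage 1 = B)
stage : {L n : ℕ} → ℕ → Grid L n → Grid L n
stage zero    B = B
stage (suc k) B = e⋆[1, k ] (stage k B)

ρN : {L n : ℕ} → Grid L n → Grid L n
ρN {L} B = stage L B

c : {L n : ℕ} → Grid L n → ℕ → ℕ → ℕ
c B k r = if r ≤ᵇ k then rowCount (stage k B) r else 0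

-- Tableaux (French): a list of rows, bottom row first.

Tableau : Set
Tableau = List (List ℕ)

ρQ : {L n : ℕ} → Grid L n → Tableau
ρQ {L} B = map (λ r → concatMap (λ k → replicate (c B k r ∸ c B (pred k) r) k) (one-to L))
               (one-to L)

-- entry in row r, column j (0-indexed)
entry : Tableau → ℕ → ℕ → Maybe ℕ
entry T r j with at T r
... | nothing  = nothing
... | just row = at row j

-- length of row r (0-indexed; 0 if absent)
rowLen : Tableau → ℕ → ℕ
rowLen T r = length (fromMaybe [] (at T r))

countEntries : ℕ → Tableau → ℕ
countEntries k T = sum (map (λ row → length (filterᵇ (k ≡ᵇ_) row)) T)

-- semistandard (French): rows weakly increase, columns strictly increase
-- from bottom to top (in particular every cell above a cell exists below).
IsSSYT : Tableau → Set
IsSSYT T =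
  (∀ r j x y → entry T r j ≡ just x → entry T r (suc j) ≡ just y → x ≤ y) ×
  (∀ r j y → entry T (suc r) j ≡ just y → ∃ λ x → entry T r j ≡ just x × x < y)

IsPartition : List ℕ → Set
IsPartition μ = Linked (λ a b → b ≤ a) μ × All (λ a → 0 < a) μ

conj : List ℕ → ℕ → ℕ
conj μ r = length (filterᵇ (r ≤ᵇ_) μ)

HasShape : Tableau → List ℕ → Set
HasShape T λ' = ∀ r → rowLen T r ≡ conj λ' (suc r)

firstGeq : ℕ → List ℕ → Maybe ℕ
firstGeq j []       = nothing
firstGeq j (x ∷ xs) = if j ≤ᵇ x then just x else firstGeq j xs

removeℕ : ℕ → List ℕ → List ℕ
removeℕ c xs = filterᵇ (λ x → not (x ≡ᵇ c)) xs

head? : List ℕ → Maybe ℕ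
head? []      = nothing
head? (x ∷ _) = just x

-- pair the balls of row r (given as (column , label) in processing order)
-- with the available (not yet labelled) balls of row r-1 (columns, increasing).
-- Returns (maj contribution , assigned (column , label) in row r-1).
pairRow : ℕ → List ℕ → List (ℕ × ℕ) → ℕ × List (ℕ × ℕ)
pairRow r avail [] = 0 , []
pairRow r avail ((j , ℓ) ∷ rest) with firstGeq j avail
... | just cc = let res = pairRow r (removeℕ cc avail) rest in
                proj₁ res , (cc , ℓ) ∷ proj₂ res
... | nothing with head? avail
...   | nothing = pairRow r avail rest
...   | just cc = let res = pairRow r (removeℕ cc avail) rest in
                  (suc ℓ ∸ r) + proj₁ res , (cc , ℓ) ∷ proj₂ res
-- (in the last case the pairing wraps: it contributes ℓ − r + 1)

lookupLabel : ℕ → List (ℕ × ℕ) → Maybe ℕ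
lookupLabel cc []             = nothing
lookupLabel cc ((x , ℓ) ∷ xs) = if x ≡ᵇ cc then just ℓ else lookupLabel cc xs

-- one step: row r (labelled) → row r-1; labels lie in 1..L, processed in
-- decreasing order of label, left to right among equal labels.
fmStep : {L n : ℕ} → Grid L n → ℕ → List (ℕ × ℕ) → ℕ × List (ℕ × ℕ)
fmStep {L} B r lab =
  let order = concatMap (λ ℓ → filterᵇ (λ p → proj₂ p ≡ᵇ ℓ) lab) (map suc (downFrom L))
      res   = pairRow r (ballCols B (pred r)) order
      newLab = map (λ cc → cc , fromMaybe (pred r) (lookupLabel cc (proj₂ res)))
                   (ballCols B (pred r))
  in proj₁ res , newLab

-- fmGo k lab : lab is the labelling of row k+1; process rows k+1, …, 2
fmGo : {L n : ℕ} → Grid L n → ℕ → List (ℕ × ℕ) → ℕ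
fmGo B zero    lab = 0
fmGo B (suc k) lab =
  let res = fmStep B (suc (suc k)) lab in proj₁ res + fmGo B k (proj₂ res)

-- maj(M); top row L gets label L (empty rows above μ₁ are harmless)
maj : {L n : ℕ} → Grid L n → ℕ
maj {L} B = fmGo B (pred L) (map (λ cc → cc , L) (ballCols B L))

-- M is a multiline queue of shape μ: row r has μ'_r balls for every r ≥ 1
-- (rows above L count as empty, so this forces μ₁ ≤ L; rows μ₁+1..L empty)
IsMLQ : {L n : ℕ} → List ℕ → Grid L n → Set
IsMLQ μ M = ∀ r → 1 ≤ r → rowCount M r ≡ conj μ r

-- M ∈ MLQ₀(μ,n)  (n is the column count fixed in the type of M)
InMLQ₀ : {L n : ℕ} → List ℕ → Grid L n → Set
InMLQ₀ μ M = IsMLQ μ M × maj M ≡ 0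

-- Say that row i + 1 is dominated by row i if every final segment of columns holds at
-- least as many balls of row i as of row i + 1. Reading Par_i column by column, e⋆_i
-- keeps in row i + 1 exactly the matched balls, which are dominated by row i. When
-- e⋆_k, …, e⋆_1 act on a grid whose rows 1..k are already successively dominated, the
-- balls e⋆_i moves down are dominated by those e⋆_{i+1} has just brought into row i + 1;
-- hence every row only grows in the dominance order and all dominations are restored.
-- So the rows of ρ_N(B) shrink upwards (giving μ) and satisfy Hall's condition on final
-- segments, which keeps the Ferrari–Martin pairing from wrapping: maj = 0. The same
-- invariant gives c^{(k)}_r ≤ c^{(k+1)}_r, c^{(k+1)}_{r+1} ≤ c^{(k)}_r and conservation
-- of the number of balls, i.e. the row, column and content conditions on ρ_Q(B).

{-# OPTIONS --safe #-}
module Submission where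

open import Data.Bool using (Bool; true; false; if_then_else_; _∧_; _∨_; not; T)
open import Data.Bool.Properties using (T-≡; ∧-zeroʳ; ∧-identityʳ; ∨-identityʳ; ∨-assoc)
open import Data.Empty using (⊥-elim)
open import Data.Fin using (toℕ)
open import Data.List using (List; []; _∷_; _++_; map; length; filterᵇ; concatMap; replicate; drop; downFrom; applyUpTo)
open import Data.List.Properties
  using (map-applyUpTo; length-map; drop-drop; drop-[]; concatMap-++; ++-identityʳ; length-++; length-replicate; map-∘; map-id)
open import Data.List.Relation.Unary.All as All using (All; []; _∷_)
open import Data.List.Relation.Unary.All.Properties using (++⁺; replicate⁺; drop⁺)
open import Data.List.Relation.Unary.AllPairs using (AllPairs; []; _∷_)
import Data.List.Relation.Unary.AllPairs.Properties as AllPairs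
open import Data.List.Relation.Unary.Linked using (Linked; []; [-]; _∷_)
open import Data.Maybe using (just; nothing)
open import Data.Nat
open import Data.Nat.ListAction using (sum)
open import Data.Nat.Properties
open import Algebra.Properties.CommutativeSemigroup +-commutativeSemigroup using (interchange)
open import Data.Product using (_×_; _,_; proj₁; proj₂; ∃)
open import Data.Sum using (_⊎_; inj₁; inj₂)
open import Data.Vec using (Vec; tabulate; toList) renaming ([] to []ᵛ; _∷_ to _∷ᵛ_)
open import Data.Vec.Properties using (length-toList)
open import Function using (_∘_)
open import Function.Bundles using (Equivalence)
open import Relation.Binary.PropositionalEquality
open import Relation.Nullary using (yes; no)
open import Relation.Nullary.Decidable using (dec-true; dec-false)
open import Defs

private
  variable
    A B : Set

T⇐≡true : {b : Bool} → b ≡ true → T b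
T⇐≡true = Equivalence.from T-≡

≡ᵇ-refl : ∀ m → (m ≡ᵇ m) ≡ true
≡ᵇ-refl m = dec-true (m ≟ m) refl

≡ᵇ-≢ : ∀ {m k} → m ≢ k → (m ≡ᵇ k) ≡ false
≡ᵇ-≢ {m} {k} = dec-false (m ≟ k)

≤ᵇ≡true : ∀ {m n} → m ≤ n → (m ≤ᵇ n) ≡ true
≤ᵇ≡true {m} {n} = dec-true (m ≤? n)

≤ᵇ≡false : ∀ {m n} → m ≰ n → (m ≤ᵇ n) ≡ false
≤ᵇ≡false {m} {n} = dec-false (m ≤? n)

∧-≡ʳ : ∀ x y → (y ≡ true → x ≡ true) → x ∧ y ≡ y
∧-≡ʳ true  y     _ = refl
∧-≡ʳ false false _ = refl
∧-≡ʳ false true  f = f refl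

∑ : (A → ℕ) → List A → ℕ
∑ f []       = 0
∑ f (x ∷ xs) = f x + ∑ f xs

∑-congᴬ : {f g : A → ℕ} (xs : List A) → All (λ x → f x ≡ g x) xs → ∑ f xs ≡ ∑ g xs
∑-congᴬ []       []       = refl
∑-congᴬ (x ∷ xs) (e ∷ es) = cong₂ _+_ e (∑-congᴬ xs es)

∑-zero : (f : A → ℕ) (xs : List A) → All (λ x → f x ≡ 0) xs → ∑ f xs ≡ 0
∑-zero f []       []       = refl
∑-zero f (x ∷ xs) (e ∷ es) rewrite e = ∑-zero f xs es

∑-++ : (f : A → ℕ) (xs ys : List A) → ∑ f (xs ++ ys) ≡ ∑ f xs + ∑ f ys
∑-++ f []       ys = refl
∑-++ f (x ∷ xs) ys = trans (cong (f x +_) (∑-++ f xs ys)) (sym (+-assoc (f x) _ _))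

∑-+ : (f g : A → ℕ) (xs : List A) → ∑ (λ x → f x + g x) xs ≡ ∑ f xs + ∑ g xs
∑-+ f g []       = refl
∑-+ f g (x ∷ xs) = trans (cong (f x + g x +_) (∑-+ f g xs)) (interchange (f x) (g x) (∑ f xs) (∑ g xs))

∑-∸ : (f g : A → ℕ) (xs : List A) → (∀ x → g x ≤ f x) → ∑ (λ x → f x ∸ g x) xs ≡ ∑ f xs ∸ ∑ g xs
∑-∸ f g xs g≤f = sym (begin
  ∑ f xs ∸ ∑ g xs                             ≡⟨ cong (_∸ ∑ g xs) f≡g+[f∸g] ⟩
  ∑ g xs + ∑ (λ x → f x ∸ g x) xs ∸ ∑ g xs   ≡⟨ m+n∸m≡n (∑ g xs) _ ⟩
  ∑ (λ x → f x ∸ g x) xs                      ∎)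
  where
  open ≡-Reasoning
  f≡g+[f∸g] : ∑ f xs ≡ ∑ g xs + ∑ (λ x → f x ∸ g x) xs
  f≡g+[f∸g] = trans (∑-congᴬ xs (All.universal (λ x → sym (m+[n∸m]≡n (g≤f x))) xs))
                    (∑-+ g (λ x → f x ∸ g x) xs)

sum-map : (f : A → ℕ) (xs : List A) → sum (map f xs) ≡ ∑ f xs
sum-map f []       = refl
sum-map f (x ∷ xs) = cong (f x +_) (sum-map f xs)

indicator : Bool → ℕ
indicator true  = 1
indicator false = 0

countᵇ : (A → Bool) → List A → ℕ
countᵇ p = ∑ (λ x → indicator (p x))

length-filterᵇ : (p : A → Bool) (xs : List A) → length (filterᵇ p xs) ≡ countᵇ p xs
length-filterᵇ p [] = refl
length-filterᵇ p (x ∷ xs) with p x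
... | true  = cong suc (length-filterᵇ p xs)
... | false = length-filterᵇ p xs

countᵇ-congᴬ : {p q : A → Bool} (xs : List A) → All (λ x → p x ≡ q x) xs → countᵇ p xs ≡ countᵇ q xs
countᵇ-congᴬ xs es = ∑-congᴬ xs (All.map (cong indicator) es)

countᵇ-cong : {p q : A → Bool} (xs : List A) → (∀ x → p x ≡ q x) → countᵇ p xs ≡ countᵇ q xs
countᵇ-cong xs e = countᵇ-congᴬ xs (All.universal e xs)

countᵇ-none : (p : A → Bool) (xs : List A) → All (λ x → p x ≡ false) xs → countᵇ p xs ≡ 0
countᵇ-none p xs es = ∑-zero _ xs (All.map (cong indicator) es)

countᵇ-all : (p : A → Bool) (xs : List A) → All (λ x → p x ≡ true) xs → countᵇ p xs ≡ length xs
countᵇ-all p []       []       = refl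
countᵇ-all p (x ∷ xs) (e ∷ es) rewrite e = cong suc (countᵇ-all p xs es)

countᵇ-mono : {p q : A → Bool} (xs : List A) → (∀ x → p x ≡ true → q x ≡ true) → countᵇ p xs ≤ countᵇ q xs
countᵇ-mono []       _ = z≤n
countᵇ-mono (x ∷ xs) f = +-mono-≤ (indicator-mono (f x)) (countᵇ-mono xs f)
  where
  indicator-mono : {a b : Bool} → (a ≡ true → b ≡ true) → indicator a ≤ indicator b
  indicator-mono {false}         _ = z≤n
  indicator-mono {true}  {true}  _ = ≤-refl
  indicator-mono {true}  {false} f with () ← f refl

countᵇ-++ : (p : A → Bool) (xs ys : List A) → countᵇ p (xs ++ ys) ≡ countᵇ p xs + countᵇ p ys
countᵇ-++ p = ∑-++ (λ x → indicator (p x))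

countᵇ-split : (p q : A → Bool) (xs : List A) →
  countᵇ p xs ≡ countᵇ (λ x → p x ∧ q x) xs + countᵇ (λ x → p x ∧ not (q x)) xs
countᵇ-split p q xs = trans (∑-congᴬ xs (All.universal (λ x → split (p x) (q x)) xs)) (∑-+ _ _ xs)
  where
  split : ∀ a b → indicator a ≡ indicator (a ∧ b) + indicator (a ∧ not b)
  split true  true  = refl
  split true  false = refl
  split false _     = refl

countᵇ-∨ : (p q : A → Bool) (xs : List A) → (∀ x → p x ∧ q x ≡ false) →
  countᵇ (λ x → p x ∨ q x) xs ≡ countᵇ p xs + countᵇ q xs
countᵇ-∨ p q xs disjoint = trans (∑-congᴬ xs (All.universal (λ x → split (p x) (q x) (disjoint x)) xs)) (∑-+ _ _ xs)
  where
  split : ∀ a b → a ∧ b ≡ false → indicator (a ∨ b) ≡ indicator a + indicator b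
  split true  false _ = refl
  split false _     _ = refl

countᵇ-filterᵇ : (p q : A → Bool) (xs : List A) → countᵇ p (filterᵇ q xs) ≡ countᵇ (λ x → q x ∧ p x) xs
countᵇ-filterᵇ p q [] = refl
countᵇ-filterᵇ p q (x ∷ xs) with q x
... | true  = cong (indicator (p x) +_) (countᵇ-filterᵇ p q xs)
... | false = countᵇ-filterᵇ p q xs

countᵇ-map : (p : B → Bool) (f : A → B) (xs : List A) → countᵇ p (map f xs) ≡ countᵇ (λ x → p (f x)) xs
countᵇ-map p f []       = refl
countᵇ-map p f (x ∷ xs) = cong (indicator (p (f x)) +_) (countᵇ-map p f xs)

countᵇ-concatMap : (p : B → Bool) (g : A → List B) (xs : List A) →
  countᵇ p (concatMap g xs) ≡ ∑ (λ x → countᵇ p (g x)) xs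
countᵇ-concatMap p g []       = refl
countᵇ-concatMap p g (x ∷ xs) =
  trans (countᵇ-++ p (g x) (concatMap g xs)) (cong (countᵇ p (g x) +_) (countᵇ-concatMap p g xs))

countᵇ-replicate : (p : A → Bool) (d : ℕ) (y : A) → countᵇ p (replicate d y) ≡ d * indicator (p y)
countᵇ-replicate p zero    y = refl
countᵇ-replicate p (suc d) y = cong (indicator (p y) +_) (countᵇ-replicate p d y)

interval : ℕ → ℕ → List ℕ
interval a zero    = []
interval a (suc m) = a ∷ interval (suc a) m

one-to≡interval : ∀ n → one-to n ≡ interval 1 n
one-to≡interval n = trans (map-applyUpTo (λ x → x) suc n) (applyUpTo-shift suc 1 n λ _ → refl)
  where
  applyUpTo-shift : ∀ f a m → (∀ x → f x ≡ a + x) → applyUpTo f m ≡ interval a m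
  applyUpTo-shift f a zero    _ = refl
  applyUpTo-shift f a (suc m) e =
    cong₂ _∷_ (trans (e 0) (+-identityʳ a))
              (applyUpTo-shift (λ x → f (suc x)) (suc a) m λ x → trans (e (suc x)) (+-suc a x))

length-interval : ∀ a m → length (interval a m) ≡ m
length-interval a zero    = refl
length-interval a (suc m) = cong suc (length-interval (suc a) m)

interval-All : {P : ℕ → Set} → ∀ a m → (∀ j → a ≤ j → j < a + m → P j) → All P (interval a m)
interval-All a zero    _ = []
interval-All a (suc m) f =
  f a ≤-refl (m<m+n a z<s) ∷
  interval-All (suc a) m λ j a<j j<a+1+m → f j (<⇒≤ a<j) (subst (j <_) (sym (+-suc a m)) j<a+1+m)

interval-++ : ∀ a m m′ → interval a (m + m′) ≡ interval a m ++ interval (a + m) m′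
interval-++ a zero    m′ = cong (λ x → interval x m′) (sym (+-identityʳ a))
interval-++ a (suc m) m′ =
  cong (a ∷_) (trans (interval-++ (suc a) m m′)
                     (cong (λ x → interval (suc a) m ++ interval x m′) (sym (+-suc a m))))

interval-∷ʳ : ∀ a m → interval a (suc m) ≡ interval a m ++ (a + m ∷ [])
interval-∷ʳ a m = subst (λ k → interval a k ≡ interval a m ++ (a + m ∷ [])) (+-comm m 1) (interval-++ a m 1)

∑-adjacent : (f g : ℕ → ℕ) (a m i : ℕ) → a ≤ i → suc i < a + m →
  (∀ R → R ≢ i → R ≢ suc i → g R ≡ f R) → g i + g (suc i) ≡ f i + f (suc i) →
  ∑ g (interval a m) ≡ ∑ f (interval a m)
∑-adjacent f g a zero i a≤i i<a _ _ =
  ⊥-elim (<-irrefl refl (≤-trans (subst (suc (suc i) ≤_) (+-identityʳ a) i<a) (m≤n⇒m≤1+n a≤i)))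
∑-adjacent f g a (suc m) i a≤i i<a+m same pair with a ≟ i
∑-adjacent f g a (suc m) i a≤i i<a+m same pair | no a≢i =
  cong₂ _+_ (same a a≢i (λ a≡1+i → <-irrefl a≡1+i (s≤s a≤i)))
            (∑-adjacent f g (suc a) m i (≤∧≢⇒< a≤i a≢i) (subst (suc i <_) (+-suc a m) i<a+m) same pair)
∑-adjacent f g a (suc zero) a a≤i i<a+m same pair | yes refl =
  ⊥-elim (<-irrefl refl (≤-trans i<a+m (≤-reflexive (+-comm a 1))))
∑-adjacent f g a (suc (suc m)) a a≤i i<a+m same pair | yes refl = begin
  g a + (g (suc a) + ∑ g rest) ≡⟨ +-assoc (g a) _ _ ⟨
  g a + g (suc a) + ∑ g rest   ≡⟨ cong₂ _+_ pair (∑-congᴬ rest (interval-All (suc (suc a)) m λ R a+2≤R _ →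
                                     same R (λ R≡a → <-irrefl (sym R≡a) (<-trans (n<1+n a) a+2≤R))
                                            (λ R≡1+a → <-irrefl (sym R≡1+a) a+2≤R))) ⟩
  f a + f (suc a) + ∑ f rest   ≡⟨ +-assoc (f a) _ _ ⟩
  f a + (f (suc a) + ∑ f rest) ∎
  where
  open ≡-Reasoning
  rest = interval (suc (suc a)) m

∑-interval-∷ʳ : (f : ℕ → ℕ) (a m : ℕ) → ∑ f (interval a (suc m)) ≡ ∑ f (interval a m) + f (a + m)
∑-interval-∷ʳ f a m = trans (cong (∑ f) (interval-∷ʳ a m))
  (trans (∑-++ f (interval a m) _) (cong (∑ f (interval a m) +_) (+-identityʳ _)))

∑-interval-vanishing : ∀ (f : ℕ → ℕ) a d → All (λ x → f x ≡ 0) (interval (suc a) d) →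
  ∑ f (interval 1 (a + d)) ≡ ∑ f (interval 1 a)
∑-interval-vanishing f a d vanish = begin
  ∑ f (interval 1 (a + d))                         ≡⟨ cong (∑ f) (interval-++ 1 a d) ⟩
  ∑ f (interval 1 a ++ interval (suc a) d)         ≡⟨ ∑-++ f (interval 1 a) _ ⟩
  ∑ f (interval 1 a) + ∑ f (interval (suc a) d)    ≡⟨ cong (∑ f (interval 1 a) +_) (∑-zero f _ vanish) ⟩
  ∑ f (interval 1 a) + 0                           ≡⟨ +-identityʳ _ ⟩
  ∑ f (interval 1 a)                               ∎
  where open ≡-Reasoning

∑-delta-∉ : (d : ℕ → ℕ) (k : ℕ) (xs : List ℕ) → All (k ≢_) xs → ∑ (λ x → d x * indicator (k ≡ᵇ x)) xs ≡ 0
∑-delta-∉ d k xs k∉xs =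
  ∑-zero _ xs (All.map (λ {x} k≢x → trans (cong (λ b → d x * indicator b) (≡ᵇ-≢ k≢x)) (*-zeroʳ (d x))) k∉xs)

∑-delta-∈ : (d : ℕ → ℕ) (k a m : ℕ) → a ≤ k → k < a + m →
  ∑ (λ x → d x * indicator (k ≡ᵇ x)) (interval a m) ≡ d k
∑-delta-∈ d k a zero    a≤k k<a+0 =
  ⊥-elim (<-irrefl refl (<-≤-trans (subst (k <_) (+-identityʳ a) k<a+0) a≤k))
∑-delta-∈ d k a (suc m) a≤k k<a+m with k ≟ a
... | yes refl rewrite ≡ᵇ-refl k =
  trans (cong₂ _+_ (*-identityʳ (d k)) (∑-delta-∉ d k _ (interval-All (suc k) m λ x k<x _ → <⇒≢ k<x)))
        (+-identityʳ (d k))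
... | no  k≢a  rewrite ≡ᵇ-≢ k≢a | *-zeroʳ (d a) =
  ∑-delta-∈ d k (suc a) m (≤∧≢⇒< a≤k (k≢a ∘ sym)) (subst (k <_) (+-suc a m) k<a+m)

at-≥length : (xs : List A) (j : ℕ) → length xs ≤ j → at xs j ≡ nothing
at-≥length []       j       _         = refl
at-≥length (x ∷ xs) (suc j) (s≤s le) = at-≥length xs j le

at-<length : (xs : List A) (j : ℕ) → j < length xs → ∃ λ y → at xs j ≡ just y
at-<length (x ∷ xs) zero    _        = x , refl
at-<length (x ∷ xs) (suc j) (s≤s lt) = at-<length xs j lt

at-replicate-just : (d : ℕ) (y z : A) (j : ℕ) → at (replicate d y) j ≡ just z → j < d × z ≡ y
at-replicate-just (suc d) y z zero    refl = z<s , refl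
at-replicate-just (suc d) y z (suc j) e    = let j<d , z≡y = at-replicate-just d y z j e in s≤s j<d , z≡y

at-++-replicate : (xs : List A) (d : ℕ) (y z : A) (j : ℕ) → at (xs ++ replicate d y) j ≡ just z →
  at xs j ≡ just z ⊎ (length xs ≤ j × j < length xs + d × z ≡ y)
at-++-replicate []       d y z j       e = inj₂ (z≤n , at-replicate-just d y z j e)
at-++-replicate (x ∷ xs) d y z zero    e = inj₁ e
at-++-replicate (x ∷ xs) d y z (suc j) e with at-++-replicate xs d y z j e
... | inj₁ earlier                 = inj₁ earlier
... | inj₂ (len≤j , j<len+d , z≡y) = inj₂ (s≤s len≤j , s≤s j<len+d , z≡y)

at-map-interval : (f : ℕ → A) (a m r : ℕ) → r < m → at (map f (interval a m)) r ≡ just (f (a + r))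
at-map-interval f a (suc m) zero    _        = cong (just ∘ f) (sym (+-identityʳ a))
at-map-interval f a (suc m) (suc r) (s≤s lt) = trans (at-map-interval f (suc a) m r lt) (cong (just ∘ f) (sym (+-suc a r)))

at-map-interval-≥ : (f : ℕ → A) (a m r : ℕ) → m ≤ r → at (map f (interval a m)) r ≡ nothing
at-map-interval-≥ f a m r m≤r =
  at-≥length (map f (interval a m)) r
    (subst (_≤ r) (sym (trans (length-map f (interval a m)) (length-interval a m))) m≤r)

private
  rows : {L n : ℕ} → Grid L n → List (List Bool)
  rows B = map toList (toList B)

  at-rows : {L n : ℕ} (B : Grid L n) (r : ℕ) →
    at (rows B) r ≡ nothing ⊎ ∃ λ (v : Vec Bool n) → at (rows B) r ≡ just (toList v)
  at-rows []ᵛ      r       = inj₁ refl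
  at-rows (v ∷ᵛ B) zero    = inj₂ (v , refl)
  at-rows (v ∷ᵛ B) (suc r) = at-rows B r

  at-rows-≥ : {L n : ℕ} (B : Grid L n) (r : ℕ) → L ≤ r → at (rows B) r ≡ nothing
  at-rows-≥ B r L≤r =
    at-≥length (rows B) r (subst (_≤ r) (sym (trans (length-map toList (toList B)) (length-toList B))) L≤r)

  at-toList-≥ : {n : ℕ} (v : Vec Bool n) (j : ℕ) → n ≤ j → at (toList v) j ≡ nothing
  at-toList-≥ v j n≤j = at-≥length (toList v) j (subst (_≤ j) (sym (length-toList v)) n≤j)

ball-row0 : {L n : ℕ} (B : Grid L n) (J : ℕ) → ball B 0 J ≡ false
ball-row0 B zero    = refl
ball-row0 B (suc J) = refl

ball-row> : {L n : ℕ} (B : Grid L n) (R J : ℕ) → L < R → ball B R J ≡ false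
ball-row> B R       zero    _         = refl
ball-row> B (suc R) (suc J) (s≤s L≤R) rewrite at-rows-≥ B R L≤R = refl

ball-col> : {L n : ℕ} (B : Grid L n) (R J : ℕ) → n < J → ball B R J ≡ false
ball-col> B zero    J       _ = ball-row0 B J
ball-col> B (suc R) (suc J) (s≤s n≤J) with at-rows B R
... | inj₁ e       rewrite e = refl
... | inj₂ (v , e) rewrite e | at-toList-≥ v J n≤J = refl

private
  at-tabulate-row : ∀ n (h : ℕ → Bool) j → j < n →
    at (toList (tabulate {n = n} λ k → h (suc (toℕ k)))) j ≡ just (h (suc j))
  at-tabulate-row (suc n) h zero    _        = refl
  at-tabulate-row (suc n) h (suc j) (s≤s lt) = at-tabulate-row n (λ x → h (suc x)) j lt

  at-tabulate-rows : ∀ L {n} (F : ℕ → Vec Bool n) r → r < L →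
    at (map toList (toList (tabulate {n = L} λ k → F (suc (toℕ k))))) r ≡ just (toList (F (suc r)))
  at-tabulate-rows (suc L) F zero    _        = refl
  at-tabulate-rows (suc L) F (suc r) (s≤s lt) = at-tabulate-rows L (λ x → F (suc x)) r lt

ball-tabulate : ∀ L n (g : ℕ → ℕ → Bool) R J → 1 ≤ R → R ≤ L → 1 ≤ J → J ≤ n →
  ball {L} {n} (tabulate λ r → tabulate λ j → g (suc (toℕ r)) (suc (toℕ j))) R J ≡ g R J
ball-tabulate L n g (suc R) (suc J) _ R≤L _ J≤n
  rewrite at-tabulate-rows L (λ R′ → tabulate {n = n} λ j → g R′ (suc (toℕ j))) R R≤L
        | at-tabulate-row n (g (suc R)) J J≤n = refl

rowCount≡countᵇ : {L n : ℕ} (G : Grid L n) (r : ℕ) → rowCount G r ≡ countᵇ (ball G r) (interval 1 n)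
rowCount≡countᵇ {n = n} G r =
  trans (length-filterᵇ (ball G r) (one-to n)) (cong (countᵇ (ball G r)) (one-to≡interval n))

-- The bracketing Par_i, read column by column

-- Column j of Par_i acting on the stack of columns of pending "(", given whether rows i+1
-- and i have a ball there. A column is read top to bottom, so its own "(" and ")" match.
colStep : ℕ → Bool → Bool → List ℕ → List ℕ
colStep j true  true  st = st
colStep j true  false st = j ∷ st
colStep j false true  st = drop 1 st
colStep j false false st = st

columnScan : (t b : ℕ → Bool) → List ℕ → List ℕ → List ℕ
columnScan t b st []       = st
columnScan t b st (j ∷ js) = columnScan t b (colStep j (t j) (b j) st) js

parScan-++ : ∀ i st xs ys → parScan i st (xs ++ ys) ≡ parScan i (parScan i st xs) ys
parScan-++ i st []             ys = refl
parScan-++ i st ((r , j) ∷ xs) ys with r ≡ᵇ suc i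
... | true  = parScan-++ i (j ∷ st) xs ys
... | false with r ≡ᵇ i
...   | true  = parScan-++ i (drop 1 st) xs ys
...   | false = parScan-++ i st xs ys

inRows : ℕ → ℕ → Bool
inRows zero    m = false
inRows (suc r) m = suc r ≤ᵇ m

inRows-≢ : ∀ {r m} → r ≢ suc m → inRows r (suc m) ≡ inRows r m
inRows-≢ {zero}  _ = refl
inRows-≢ {suc r} {m} r≢ with suc r ≤? m
... | yes r<m = trans (≤ᵇ≡true (m≤n⇒m≤1+n r<m)) (sym (≤ᵇ≡true r<m))
... | no  r≰m = trans (≤ᵇ≡false r≰1+m) (sym (≤ᵇ≡false r≰m))
  where
  r≰1+m : suc r ≰ suc m
  r≰1+m r≤m = r≢ (cong suc (≤-antisym (s≤s⁻¹ r≤m) (s≤s⁻¹ (≰⇒> r≰m))))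

m≢1+m : ∀ m → m ≢ suc m
m≢1+m m eq = 1+n≢n (sym eq)

inRows-self : ∀ m → inRows (suc m) (suc m) ≡ true
inRows-self m = ≤ᵇ≡true (≤-refl {suc m})

inRows-> : ∀ {r m} → m < r → inRows r m ≡ false
inRows-> {suc r} {m} m<r = ≤ᵇ≡false (<⇒≱ m<r)

inRows-skip : (occupied : ℕ → Bool) (r : ℕ) {m : ℕ} → occupied (suc m) ≡ false →
  inRows r (suc m) ∧ occupied r ≡ inRows r m ∧ occupied r
inRows-skip occupied r {m} free with r ≟ suc m
... | yes refl rewrite free | inRows-self m | inRows-> (n<1+n m) = refl
... | no  r≢   rewrite inRows-≢ r≢ = refl

columnLetters : (ℕ → Bool) → ℕ → ℕ → List (ℕ × ℕ)
columnLetters occupied j m = map (λ r → r , j) (filterᵇ occupied (map suc (downFrom m)))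

parScan-column : (occupied : ℕ → Bool) (i j m : ℕ) (st : List ℕ) →
  parScan i st (columnLetters occupied j m) ≡
  colStep j (inRows (suc i) m ∧ occupied (suc i)) (inRows i m ∧ occupied i) st
parScan-column occ zero    j zero    st = refl
parScan-column occ (suc i) j zero    st = refl
parScan-column occ i       j (suc m) st with occ (suc m) in occ-m
... | false rewrite inRows-skip occ (suc i) occ-m | inRows-skip occ i occ-m = parScan-column occ i j m st
... | true with i ≟ m
...   | yes refl
  rewrite ≡ᵇ-refl m | parScan-column occ m j m (j ∷ st)
        | inRows-> (n<1+n m) | inRows-self m | occ-m | inRows-≢ (m≢1+m m)
  = push-then-close (inRows m m ∧ occ m)
  where
  push-then-close : ∀ x → colStep j false x (j ∷ st) ≡ colStep j true x st
  push-then-close true  = refl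
  push-then-close false = refl
...   | no i≢m with i ≟ suc m
...     | yes refl
  rewrite ≡ᵇ-≢ (m≢1+m m) | ≡ᵇ-refl m | parScan-column occ (suc m) j m (drop 1 st)
        | inRows-> (m≤n⇒m≤1+n (n<1+n m)) | inRows-> (n<1+n m)
        | inRows-self m | occ-m
  = refl
...     | no i≢1+m
  rewrite ≡ᵇ-≢ (i≢m ∘ sym) | ≡ᵇ-≢ (i≢1+m ∘ sym)
        | inRows-≢ (i≢m ∘ suc-injective) | inRows-≢ i≢1+m
  = parScan-column occ i j m st

inRows-ball : {L n : ℕ} (B : Grid L n) (r j : ℕ) → inRows r L ∧ ball B r j ≡ ball B r j
inRows-ball B zero    j rewrite ball-row0 B j = refl
inRows-ball {L} B (suc r) j with suc r ≤? L
... | yes r≤L rewrite ≤ᵇ≡true r≤L = refl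
... | no  r≰L rewrite ≤ᵇ≡false r≰L | ball-row> B (suc r) j (≰⇒> r≰L) = refl

unmatchedAbove≡columnScan : {L n : ℕ} (i : ℕ) (B : Grid L n) →
  unmatchedAbove i B ≡ columnScan (ball B (suc i)) (ball B i) [] (interval 1 n)
unmatchedAbove≡columnScan {L} {n} i B =
  trans (parScan-columns (one-to n) []) (cong (columnScan _ _ []) (one-to≡interval n))
  where
  parScan-columns : ∀ js st →
    parScan i st (concatMap (λ j → columnLetters (λ r → ball B r j) j L) js) ≡
    columnScan (ball B (suc i)) (ball B i) st js
  parScan-columns []       st = refl
  parScan-columns (j ∷ js) st
    rewrite parScan-++ i st (columnLetters (λ r → ball B r j) j L)
                            (concatMap (λ j → columnLetters (λ r → ball B r j) j L) js)
          | parScan-column (λ r → ball B r j) i j L st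
          | inRows-ball B (suc i) j | inRows-ball B i j
    = parScan-columns js (colStep j (ball B (suc i) j) (ball B i j) st)

-- The number of ")" left unmatched by a right-to-left reading of the columns js.
excess : (t b : ℕ → Bool) → List ℕ → ℕ
excess t b []       = 0
excess t b (j ∷ js) = step (t j) (b j) (excess t b js)
  where
  step : Bool → Bool → ℕ → ℕ
  step true  false e = pred e
  step false true  e = suc e
  step _     _     e = e

unmatchedᵇ : Bool → Bool → ℕ → Bool
unmatchedᵇ true false zero = true
unmatchedᵇ _    _     _    = false

Unmatched : ℕ → (t b : ℕ → Bool) → ℕ → Bool
Unmatched n t b j = unmatchedᵇ (t j) (b j) (excess t b (interval (suc j) (n ∸ j)))

private
  pred-∸ : ∀ e a → pred e ∸ a ≡ e ∸ suc a
  pred-∸ zero    zero    = refl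
  pred-∸ zero    (suc a) = refl
  pred-∸ (suc e) a       = refl

columnScan-++ : ∀ t b ys (A S : List ℕ) →
  columnScan t b (A ++ S) ys ≡ columnScan t b A ys ++ drop (excess t b ys ∸ length A) S
columnScan-++ t b [] A S rewrite 0∸n≡0 (length A) = refl
columnScan-++ t b (j ∷ ys) A S with t j | b j
... | true  | true  = columnScan-++ t b ys A S
... | false | false = columnScan-++ t b ys A S
... | true  | false rewrite columnScan-++ t b ys (j ∷ A) S | pred-∸ (excess t b ys) (length A) = refl
... | false | true with A
...   | []     rewrite columnScan-++ t b ys [] (drop 1 S) | drop-drop 1 (excess t b ys) S = refl
...   | a ∷ A′ = columnScan-++ t b ys A′ S

memℕ-++ : ∀ j xs ys → memℕ j (xs ++ ys) ≡ memℕ j xs ∨ memℕ j ys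
memℕ-++ j []       ys = refl
memℕ-++ j (x ∷ xs) ys = trans (cong ((j ≡ᵇ x) ∨_) (memℕ-++ j xs ys)) (sym (∨-assoc (j ≡ᵇ x) _ _))

memℕ-∉ : ∀ j xs → All (j ≢_) xs → memℕ j xs ≡ false
memℕ-∉ j []       []           = refl
memℕ-∉ j (x ∷ xs) (j≢x ∷ j∉xs) rewrite ≡ᵇ-≢ j≢x = memℕ-∉ j xs j∉xs

columnScan-All : {P : ℕ → Set} (t b : ℕ → Bool) (st js : List ℕ) → All P st → All P js → All P (columnScan t b st js)
columnScan-All t b st []       Pst _          = Pst
columnScan-All {P} t b st (j ∷ js) Pst (Pj ∷ Pjs) = columnScan-All t b _ js (colStep-All (t j) (b j)) Pjs
  where
  colStep-All : ∀ x y → All P (colStep j x y st)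
  colStep-All true  true  = Pst
  colStep-All true  false = Pj ∷ Pst
  colStep-All false true  = drop⁺ 1 Pst
  colStep-All false false = Pst

∸-of-+ : ∀ {n a m} → a + suc m ≡ suc n → n ∸ a ≡ m
∸-of-+ {n} {a} {m} a+m≡1+n = trans (cong (_∸ a) (suc-injective (trans (sym a+m≡1+n) (+-suc a m)))) (m+n∸m≡n a m)

-- A "(" pushed at column j survives the scan of the columns to its right iff
-- they leave no ")" unmatched.
memℕ-columnScan : ∀ n t b a m → a + m ≡ suc n → ∀ j → a ≤ j → j ≤ n →
  memℕ j (columnScan t b [] (interval a m)) ≡ Unmatched n t b j
memℕ-columnScan n t b a zero a+0≡1+n j a≤j j≤n =
  ⊥-elim (<-irrefl refl (≤-trans (subst (_≤ j) (trans (sym (+-identityʳ a)) a+0≡1+n) a≤j) j≤n))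
memℕ-columnScan n t b a (suc m) a+m≡1+n j a≤j j≤n
  rewrite columnScan-++ t b (interval (suc a) m) [] (colStep a (t a) (b a) [])
        | memℕ-++ j (columnScan t b [] (interval (suc a) m))
                    (drop (excess t b (interval (suc a) m)) (colStep a (t a) (b a) []))
  with j ≟ a
... | yes refl = begin
  memℕ j (columnScan t b [] rest) ∨ memℕ j (drop (excess t b rest) (colStep j (t j) (b j) []))
    ≡⟨ cong₂ _∨_ (memℕ-∉ j _ (columnScan-All t b [] rest [] (interval-All (suc j) m λ x j<x _ → <⇒≢ j<x)))
                 (surviving (t j) (b j) (excess t b rest)) ⟩
  false ∨ unmatchedᵇ (t j) (b j) (excess t b rest)
    ≡⟨ cong (λ k → unmatchedᵇ (t j) (b j) (excess t b (interval (suc j) k))) (sym (∸-of-+ a+m≡1+n)) ⟩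
  Unmatched n t b j ∎
  where
  open ≡-Reasoning
  rest = interval (suc j) m
  surviving : ∀ x y e → memℕ j (drop e (colStep j x y [])) ≡ unmatchedᵇ x y e
  surviving true  false zero    rewrite ≡ᵇ-refl j = refl
  surviving true  false (suc e) rewrite drop-[] {A = ℕ} e = refl
  surviving true  true  e       rewrite drop-[] {A = ℕ} e = refl
  surviving false true  e       rewrite drop-[] {A = ℕ} e = refl
  surviving false false e       rewrite drop-[] {A = ℕ} e = refl
... | no j≢a =
  trans (cong₂ _∨_ (memℕ-columnScan n t b (suc a) m (trans (sym (+-suc a m)) a+m≡1+n)
                                    j (≤∧≢⇒< a≤j (j≢a ∘ sym)) j≤n)
                   (memℕ-∉ j _ (drop⁺ (excess t b (interval (suc a) m)) (only-a (t a) (b a)))))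
        (∨-identityʳ (Unmatched n t b j))
  where
  only-a : ∀ x y → All (j ≢_) (colStep a x y [])
  only-a true  false = j≢a ∷ []
  only-a true  true  = []
  only-a false true  = []
  only-a false false = []

private
  moveDown : ℕ → (ℕ → ℕ → Bool) → Bool → ℕ → ℕ → Bool
  moveDown i β moved R J =
    if R ≡ᵇ suc i then β R J ∧ not moved
    else if R ≡ᵇ i then β R J ∨ moved
    else β R J

  moveDown-empty : ∀ i β moved R J → β R J ≡ false → (R ≡ i → moved ≡ false) → moveDown i β moved R J ≡ false
  moveDown-empty i β moved R J empty nothing-moved with R ≡ᵇ suc i
  ... | true rewrite empty = refl
  ... | false with R ≡ᵇ i in R≡ᵇi
  ...   | false = empty
  ...   | true rewrite empty | nothing-moved (≡ᵇ⇒≡ R i (T⇐≡true R≡ᵇi)) = refl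

  Unmatched-empty : ∀ n t b j → t j ≡ false → Unmatched n t b j ≡ false
  Unmatched-empty n t b j empty rewrite empty = refl

  ball-e⋆ : {L n : ℕ} (B : Grid L n) (i : ℕ) → 1 ≤ i → ∀ R J →
    ball (e⋆ i B) R J ≡ moveDown i (ball B) (Unmatched n (ball B (suc i)) (ball B i) J) R J
  ball-e⋆ B i 1≤i zero J = trans (ball-row0 (e⋆ i B) J)
    (sym (moveDown-empty i (ball B) _ 0 J (ball-row0 B J) λ 0≡i → ⊥-elim (<-irrefl 0≡i 1≤i)))
  ball-e⋆ B i 1≤i (suc R) zero = sym (moveDown-empty i (ball B) _ (suc R) 0 refl λ _ → refl)
  ball-e⋆ {L} {n} B i 1≤i (suc R) (suc J) with suc R ≤? L | suc J ≤? n
  ... | no R≰L | _ = trans (ball-row> (e⋆ i B) (suc R) (suc J) (≰⇒> R≰L))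
    (sym (moveDown-empty i (ball B) _ (suc R) (suc J) (ball-row> B (suc R) (suc J) (≰⇒> R≰L))
      λ { refl → Unmatched-empty n _ _ (suc J) (ball-row> B (suc (suc R)) (suc J) (m≤n⇒m≤1+n (≰⇒> R≰L))) }))
  ... | yes _ | no J≰n = trans (ball-col> (e⋆ i B) (suc R) (suc J) (≰⇒> J≰n))
    (sym (moveDown-empty i (ball B) _ (suc R) (suc J) (ball-col> B (suc R) (suc J) (≰⇒> J≰n))
      λ _ → Unmatched-empty n _ _ (suc J) (ball-col> B (suc i) (suc J) (≰⇒> J≰n))))
  ... | yes R≤L | yes J≤n =
    trans (ball-tabulate L n (λ R J → moveDown i (ball B) (memℕ J (unmatchedAbove i B)) R J)
                         (suc R) (suc J) (s≤s z≤n) R≤L (s≤s z≤n) J≤n)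
          (cong (λ moved → moveDown i (ball B) moved (suc R) (suc J))
                (trans (cong (memℕ (suc J)) (unmatchedAbove≡columnScan i B))
                       (memℕ-columnScan n _ _ 1 n refl (suc J) (s≤s z≤n) J≤n)))

module _ {L n : ℕ} (B : Grid L n) (i : ℕ) (1≤i : 1 ≤ i) (J : ℕ) where

  ball-e⋆-upper : ball (e⋆ i B) (suc i) J ≡ ball B (suc i) J ∧ not (Unmatched n (ball B (suc i)) (ball B i) J)
  ball-e⋆-upper rewrite ball-e⋆ B i 1≤i (suc i) J | ≡ᵇ-refl i = refl

  ball-e⋆-lower : ball (e⋆ i B) i J ≡ ball B i J ∨ Unmatched n (ball B (suc i)) (ball B i) J
  ball-e⋆-lower rewrite ball-e⋆ B i 1≤i i J | ≡ᵇ-≢ (m≢1+m i) | ≡ᵇ-refl i = refl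

  ball-e⋆-other : ∀ {R} → R ≢ suc i → R ≢ i → ball (e⋆ i B) R J ≡ ball B R J
  ball-e⋆-other {R} R≢1+i R≢i rewrite ball-e⋆ B i 1≤i R J | ≡ᵇ-≢ R≢1+i | ≡ᵇ-≢ R≢i = refl

-- Dominance on final segments

-- interval a m with a + m ≡ 1 + n is the final segment a..n of the columns (for a = 0 it
-- also contains column 0, which never holds a ball).
Dominated : ℕ → (ℕ → Bool) → (ℕ → Bool) → Set
Dominated n P Q = ∀ a m → a + m ≡ suc n → countᵇ P (interval a m) ≤ countᵇ Q (interval a m)

Dominated-trans : ∀ {n P Q R} → Dominated n P Q → Dominated n Q R → Dominated n P R
Dominated-trans P≼Q Q≼R a m eq = ≤-trans (P≼Q a m eq) (Q≼R a m eq)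

⊆⇒Dominated : ∀ {n P Q} → (∀ j → P j ≡ true → Q j ≡ true) → Dominated n P Q
⊆⇒Dominated P⊆Q a m _ = countᵇ-mono (interval a m) P⊆Q

Dominated⇒≤ : ∀ {n P Q} → Dominated n P Q → countᵇ P (interval 1 n) ≤ countᵇ Q (interval 1 n)
Dominated⇒≤ {n} P≼Q = P≼Q 1 n refl

Dominated-cong : ∀ {n P P′ Q Q′} → (∀ j → P′ j ≡ P j) → (∀ j → Q j ≡ Q′ j) → Dominated n P Q → Dominated n P′ Q′
Dominated-cong P′≗P Q≗Q′ P≼Q a m eq =
  subst₂ _≤_ (countᵇ-cong (interval a m) (λ j → sym (P′≗P j))) (countᵇ-cong (interval a m) Q≗Q′) (P≼Q a m eq)

private
  unmatchedCount : (t b : ℕ → Bool) → List ℕ → ℕ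
  unmatchedCount t b []       = 0
  unmatchedCount t b (j ∷ ys) = indicator (unmatchedᵇ (t j) (b j) (excess t b ys)) + unmatchedCount t b ys

  bracket-balance : ∀ t b zs → countᵇ t zs + excess t b zs ≡ countᵇ b zs + unmatchedCount t b zs
  bracket-balance t b [] = refl
  bracket-balance t b (j ∷ ys) with t j | b j | bracket-balance t b ys
  ... | true  | true  | ih = cong suc ih
  ... | false | false | ih = ih
  ... | false | true  | ih = trans (+-suc (countᵇ t ys) (excess t b ys)) (cong suc ih)
  ... | true  | false | ih with excess t b ys
  ...   | zero  = trans (cong suc ih) (sym (+-suc (countᵇ b ys) (unmatchedCount t b ys)))
  ...   | suc e = trans (sym (+-suc (countᵇ t ys) e)) ih

  unmatchedCount≡countᵇ : ∀ n t b a m → a + m ≡ suc n →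
    unmatchedCount t b (interval a m) ≡ countᵇ (Unmatched n t b) (interval a m)
  unmatchedCount≡countᵇ n t b a zero    _ = refl
  unmatchedCount≡countᵇ n t b a (suc m) eq rewrite ∸-of-+ eq =
    cong (_ +_) (unmatchedCount≡countᵇ n t b (suc a) m (trans (sym (+-suc a m)) eq))

  unmatched⇒excess≡0 : ∀ t b j ys → unmatchedᵇ (t j) (b j) (excess t b ys) ≡ true → excess t b (j ∷ ys) ≡ 0
  unmatched⇒excess≡0 t b j ys u with t j | b j | excess t b ys
  ... | true  | false | zero = refl
  ... | true  | true  | _    with () ← u
  ... | false | true  | _    with () ← u
  ... | false | false | _    with () ← u

  unmatchedᵇ-top : ∀ {x y e} → unmatchedᵇ x y e ≡ true → x ≡ true
  unmatchedᵇ-top {true} {false} {zero} _ = refl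

  unmatchedᵇ-bottom : ∀ {x y e} → unmatchedᵇ x y e ≡ true → y ≡ false
  unmatchedᵇ-bottom {true} {false} {zero} _ = refl

countᵇ-matched+unmatched : ∀ n t b zs →
  countᵇ t zs ≡ countᵇ (λ j → t j ∧ not (Unmatched n t b j)) zs + countᵇ (Unmatched n t b) zs
countᵇ-matched+unmatched n t b zs =
  trans (countᵇ-split t (Unmatched n t b) zs)
        (trans (+-comm (countᵇ (λ j → t j ∧ U j) zs) _)
               (cong (countᵇ (λ j → t j ∧ not (U j)) zs +_)
                     (countᵇ-cong zs λ j → ∧-≡ʳ (t j) (U j) unmatchedᵇ-top)))
  where
  U = Unmatched n t b

matched-Dominated : ∀ n t b → Dominated n (λ j → t j ∧ not (Unmatched n t b j)) b
matched-Dominated n t b a m eq = +-cancelʳ-≤ (countᵇ U zs) _ _ (begin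
  countᵇ (λ j → t j ∧ not (U j)) zs + countᵇ U zs ≡⟨ countᵇ-matched+unmatched n t b zs ⟨
  countᵇ t zs                                     ≤⟨ m≤m+n _ _ ⟩
  countᵇ t zs + excess t b zs                     ≡⟨ bracket-balance t b zs ⟩
  countᵇ b zs + unmatchedCount t b zs             ≡⟨ cong (countᵇ b zs +_) (unmatchedCount≡countᵇ n t b a m eq) ⟩
  countᵇ b zs + countᵇ U zs                       ∎)
  where
  open ≤-Reasoning
  U = Unmatched n t b
  zs = interval a m

-- On a final segment starting at an unmatched ball every ")" is matched, so there
-- #unmatched = #t − #b ≤ #p; any other final segment reduces to a shorter one.
unmatched-Dominated : ∀ n t b p →
  (∀ a m → a + m ≡ suc n → countᵇ t (interval a m) ≤ countᵇ b (interval a m) + countᵇ p (interval a m)) →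
  Dominated n (Unmatched n t b) p
unmatched-Dominated n t b p t≼b+p a m eq =
  subst (_≤ countᵇ p (interval a m)) (unmatchedCount≡countᵇ n t b a m eq) (bound a m eq)
  where
  balanced : ∀ zs → excess t b zs ≡ 0 → countᵇ t zs ≤ countᵇ b zs + countᵇ p zs →
    unmatchedCount t b zs ≤ countᵇ p zs
  balanced zs no-excess t≤b+p = +-cancelˡ-≤ (countᵇ b zs) _ _ (begin
    countᵇ b zs + unmatchedCount t b zs ≡⟨ bracket-balance t b zs ⟨
    countᵇ t zs + excess t b zs         ≡⟨ cong (countᵇ t zs +_) no-excess ⟩
    countᵇ t zs + 0                     ≡⟨ +-identityʳ _ ⟩
    countᵇ t zs                         ≤⟨ t≤b+p ⟩
    countᵇ b zs + countᵇ p zs           ∎)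
    where open ≤-Reasoning
  bound : ∀ a m → a + m ≡ suc n → unmatchedCount t b (interval a m) ≤ countᵇ p (interval a m)
  bound a zero    _  = z≤n
  bound a (suc m) eq with unmatchedᵇ (t a) (b a) (excess t b (interval (suc a) m)) in u
  ... | true  = subst (λ x → indicator x + unmatchedCount t b (interval (suc a) m) ≤ countᵇ p (interval a (suc m))) u
                      (balanced (interval a (suc m)) (unmatched⇒excess≡0 t b a (interval (suc a) m) u)
                                (t≼b+p a (suc m) eq))
  ... | false = ≤-trans (bound (suc a) m (trans (sym (+-suc a m)) eq)) (m≤n+m _ (indicator (p a)))

countᵇ-moved+kept : ∀ n t b zs →
  countᵇ (λ j → b j ∨ Unmatched n t b j) zs + countᵇ (λ j → t j ∧ not (Unmatched n t b j)) zs ≡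
  countᵇ b zs + countᵇ t zs
countᵇ-moved+kept n t b zs = begin
  countᵇ (λ j → b j ∨ U j) zs + countᵇ (λ j → t j ∧ not (U j)) zs  ≡⟨ cong (_+ countᵇ (λ j → t j ∧ not (U j)) zs)
                                                                        (countᵇ-∨ b U zs disjoint) ⟩
  countᵇ b zs + countᵇ U zs + countᵇ (λ j → t j ∧ not (U j)) zs    ≡⟨ +-assoc (countᵇ b zs) _ _ ⟩
  countᵇ b zs + (countᵇ U zs + countᵇ (λ j → t j ∧ not (U j)) zs)  ≡⟨ cong (countᵇ b zs +_) (+-comm (countᵇ U zs) _) ⟩
  countᵇ b zs + (countᵇ (λ j → t j ∧ not (U j)) zs + countᵇ U zs)  ≡⟨ cong (countᵇ b zs +_) (countᵇ-matched+unmatched n t b zs) ⟨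
  countᵇ b zs + countᵇ t zs                                        ∎
  where
  open ≡-Reasoning
  U = Unmatched n t b
  disjoint : ∀ j → b j ∧ U j ≡ false
  disjoint j with U j in u
  ... | true  rewrite unmatchedᵇ-bottom {t j} {b j} u = refl
  ... | false = ∧-zeroʳ (b j)

-- On final segments t ≤ g + (t − g) ≤ b + (t − g), so the unmatched balls of t are dominated
-- by t − g, and hence g by the matched ones.
Dominated-by-matched : ∀ n t b g → (∀ j → g j ≡ true → t j ≡ true) → Dominated n g b →
  Dominated n g (λ j → t j ∧ not (Unmatched n t b j))
Dominated-by-matched n t b g g⊆t g≼b a m eq = +-cancelʳ-≤ (countᵇ U I) _ _ (begin
  countᵇ g I + countᵇ U I                          ≤⟨ +-monoʳ-≤ _ (unmatched≼fresh a m eq) ⟩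
  countᵇ g I + countᵇ fresh I                      ≡⟨ t-split I ⟨
  countᵇ t I                                       ≡⟨ countᵇ-matched+unmatched n t b I ⟩
  countᵇ (λ j → t j ∧ not (U j)) I + countᵇ U I    ∎)
  where
  open ≤-Reasoning
  U = Unmatched n t b
  I = interval a m
  fresh : ℕ → Bool
  fresh j = t j ∧ not (g j)
  t-split : ∀ zs → countᵇ t zs ≡ countᵇ g zs + countᵇ fresh zs
  t-split zs = trans (countᵇ-split t g zs) (cong (_+ countᵇ fresh zs) (countᵇ-cong zs λ j → ∧-≡ʳ (t j) (g j) (g⊆t j)))
  unmatched≼fresh : Dominated n U fresh
  unmatched≼fresh = unmatched-Dominated n t b fresh λ a m eq →
    let I = interval a m in begin
    countᵇ t I                    ≡⟨ t-split I ⟩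
    countᵇ g I + countᵇ fresh I   ≤⟨ +-monoˡ-≤ _ (g≼b a m eq) ⟩
    countᵇ b I + countᵇ fresh I   ∎

-- The collapsing invariant

module Collapse {L n : ℕ} (B : Grid L n) where

  size : Grid L n → ℕ → ℕ
  size G r = countᵇ (ball G r) (interval 1 n)

  record Collapsed (k : ℕ) (G : Grid L n) : Set where
    field
      unchanged : ∀ R J → k < R → ball G R J ≡ ball B R J
      dominated : ∀ i → 1 ≤ i → suc i ≤ k → Dominated n (ball G (suc i)) (ball G i)

  -- H is obtained from G by e⋆_m e⋆_{m+1} ⋯ e⋆_k.
  record Sweep (k : ℕ) (G H : Grid L n) (m : ℕ) : Set where
    field
      below     : ∀ R J → R < m → ball H R J ≡ ball G R J
      above     : ∀ R J → suc k < R → ball H R J ≡ ball G R J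
      grows     : m ≤ k → ∀ J → ball G m J ≡ true → ball H m J ≡ true
      new≼old   : ∀ R → m ≤ R → R ≤ k → Dominated n (ball H (suc R)) (ball G R)
      old≼new   : ∀ R → m < R → R ≤ k → Dominated n (ball G R) (ball H R)
      conserved : ∑ (size H) (interval 1 (suc k)) ≡ ∑ (size G) (interval 1 k) + size G (suc k)

  sweep-start : ∀ k G → Sweep k G G (suc k)
  sweep-start k G = record
    { below     = λ _ _ _ → refl
    ; above     = λ _ _ _ → refl
    ; grows     = λ k<k → ⊥-elim (<-irrefl refl k<k)
    ; new≼old   = λ R k<R R≤k → ⊥-elim (<-irrefl refl (<-≤-trans k<R R≤k))
    ; old≼new   = λ R k<R R≤k → ⊥-elim (<-irrefl refl (<-≤-trans (<-trans (n<1+n k) k<R) R≤k))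
    ; conserved = ∑-interval-∷ʳ (size G) 1 k
    }

  sweep-step : ∀ k G H i → 1 ≤ i → i ≤ k → Collapsed k G → Sweep k G H (suc i) → Sweep k G (e⋆ i H) i
  sweep-step k G H i 1≤i i≤k collapsed sweep = record
    { below = below′ ; above = above′ ; grows = grows′
    ; new≼old = new≼old′ ; old≼new = old≼new′ ; conserved = conserved′ }
    where
    open Sweep sweep
    H′ = e⋆ i H
    U = Unmatched n (ball H (suc i)) (ball H i)
    upper : ∀ J → ball H′ (suc i) J ≡ ball H (suc i) J ∧ not (U J)
    upper = ball-e⋆-upper H i 1≤i
    lower : ∀ J → ball H′ i J ≡ ball H i J ∨ U J
    lower = ball-e⋆-lower H i 1≤i
    other : ∀ {R} → R ≢ suc i → R ≢ i → ∀ J → ball H′ R J ≡ ball H R J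
    other R≢1+i R≢i J = ball-e⋆-other H i 1≤i J R≢1+i R≢i
    H≗G-at-i : ∀ J → ball H i J ≡ ball G i J
    H≗G-at-i J = below i J (n<1+n i)

    below′ : ∀ R J → R < i → ball H′ R J ≡ ball G R J
    below′ R J R<i = trans (other (<⇒≢ (m<n⇒m<1+n R<i)) (<⇒≢ R<i) J) (below R J (m<n⇒m<1+n R<i))

    above′ : ∀ R J → suc k < R → ball H′ R J ≡ ball G R J
    above′ R J k+1<R = trans (other (>⇒≢ i+1<R) (>⇒≢ (<-trans (n<1+n i) i+1<R)) J) (above R J k+1<R)
      where i+1<R = ≤-<-trans (s≤s i≤k) k+1<R

    grows′ : i ≤ k → ∀ J → ball G i J ≡ true → ball H′ i J ≡ true
    grows′ _ J Gi rewrite lower J | H≗G-at-i J | Gi = refl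

    new≼old′ : ∀ R → i ≤ R → R ≤ k → Dominated n (ball H′ (suc R)) (ball G R)
    new≼old′ R i≤R R≤k with R ≟ i
    ... | yes refl = Dominated-cong upper H≗G-at-i (matched-Dominated n (ball H (suc i)) (ball H i))
    ... | no R≢i = Dominated-cong (other (R≢i ∘ suc-injective) (>⇒≢ (m<n⇒m<1+n i<R))) (λ _ → refl)
                                  (new≼old R i<R R≤k)
      where i<R = ≤∧≢⇒< i≤R (R≢i ∘ sym)

    old≼upper : suc i ≤ k → Dominated n (ball G (suc i)) (ball H′ (suc i))
    old≼upper i<k = Dominated-cong (λ _ → refl) (λ J → sym (upper J))
      (Dominated-by-matched n (ball H (suc i)) (ball H i) (ball G (suc i)) (grows i<k)
        (Dominated-cong (λ _ → refl) (λ J → sym (H≗G-at-i J)) (Collapsed.dominated collapsed i 1≤i i<k)))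

    old≼new′ : ∀ R → i < R → R ≤ k → Dominated n (ball G R) (ball H′ R)
    old≼new′ R i<R R≤k with R ≟ suc i
    ... | yes refl = old≼upper R≤k
    ... | no R≢1+i = Dominated-cong (λ _ → refl) (λ J → sym (other R≢1+i (>⇒≢ i<R) J))
                                    (old≼new R (≤∧≢⇒< i<R (R≢1+i ∘ sym)) R≤k)

    conserved′ : ∑ (size H′) (interval 1 (suc k)) ≡ ∑ (size G) (interval 1 k) + size G (suc k)
    conserved′ = trans (∑-adjacent (size H) (size H′) 1 (suc k) i 1≤i (s≤s (s≤s i≤k))
                                   (λ R R≢i R≢1+i → countᵇ-cong (interval 1 n) (other R≢1+i R≢i)) pair)
                       conserved
      where
      pair : size H′ i + size H′ (suc i) ≡ size H i + size H (suc i)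
      pair = trans (cong₂ _+_ (countᵇ-cong (interval 1 n) lower) (countᵇ-cong (interval 1 n) upper))
                   (countᵇ-moved+kept n _ _ (interval 1 n))

  sweep : ∀ k G → Collapsed k G → ∀ m c → m + c ≡ suc k → 1 ≤ m → Sweep k G (eSeq (interval m c) G) m
  sweep k G collapsed m zero    m+0≡1+k _   =
    subst (Sweep k G G) (sym (trans (sym (+-identityʳ m)) m+0≡1+k)) (sweep-start k G)
  sweep k G collapsed m (suc c) m+c≡1+k 1≤m =
    sweep-step k G _ m 1≤m (subst (m ≤_) m+c≡k (m≤m+n m c)) collapsed
               (sweep k G collapsed (suc m) c (trans (sym (+-suc m c)) m+c≡1+k) (s≤s z≤n))
    where m+c≡k = suc-injective (trans (sym (+-suc m c)) m+c≡1+k)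

  sweep-old≼new : ∀ {k G H} → Sweep k G H 1 → ∀ R → 1 ≤ R → R ≤ k → Dominated n (ball G R) (ball H R)
  sweep-old≼new S R 1≤R R≤k with R ≟ 1
  ... | yes refl = ⊆⇒Dominated (Sweep.grows S R≤k)
  ... | no  R≢1  = Sweep.old≼new S R (≤∧≢⇒< 1≤R (R≢1 ∘ sym)) R≤k

  collapsed : ∀ k → Collapsed k (stage k B)
  stage-sweep : ∀ k → Sweep k (stage k B) (stage (suc k) B) 1

  stage-sweep k = subst (λ H → Sweep k (stage k B) H 1)
                        (cong (λ cols → eSeq cols (stage k B)) (sym (one-to≡interval k)))
                        (sweep k (stage k B) (collapsed k) 1 k refl ≤-refl)

  collapsed zero    = record { unchanged = λ _ _ _ → refl ; dominated = λ _ _ () }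
  collapsed (suc k) = record
    { unchanged = λ R J k+1<R → trans (Sweep.above S R J k+1<R)
                                      (Collapsed.unchanged (collapsed k) R J (<-trans (n<1+n k) k+1<R))
    ; dominated = λ i 1≤i i<k+1 → Dominated-trans (Sweep.new≼old S i 1≤i (s≤s⁻¹ i<k+1))
                                                   (sweep-old≼new S i 1≤i (s≤s⁻¹ i<k+1))
    }
    where S = stage-sweep k

  size-mono : ∀ k R → 1 ≤ R → R ≤ k → size (stage k B) R ≤ size (stage (suc k) B) R
  size-mono k R 1≤R R≤k = Dominated⇒≤ (sweep-old≼new (stage-sweep k) R 1≤R R≤k)

  size-strip : ∀ k R → 1 ≤ R → R ≤ k → size (stage (suc k) B) (suc R) ≤ size (stage k B) R
  size-strip k R 1≤R R≤k = Dominated⇒≤ (Sweep.new≼old (stage-sweep k) R 1≤R R≤k)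

  size-conserved : ∀ k →
    ∑ (size (stage (suc k) B)) (interval 1 (suc k)) ≡ ∑ (size (stage k B)) (interval 1 k) + size B (suc k)
  size-conserved k = trans (Sweep.conserved (stage-sweep k))
    (cong (∑ (size (stage k B)) (interval 1 k) +_)
          (countᵇ-cong (interval 1 n) λ J → Collapsed.unchanged (collapsed k) (suc k) J (n<1+n k)))

Increasing : (ℕ → ℕ) → Set
Increasing f = ∀ k → f k ≤ f (suc k)

Increasing⇒mono : ∀ {f} → Increasing f → ∀ {a b} → a ≤ b → f a ≤ f b
Increasing⇒mono {f} step {a} a≤b = go (≤⇒≤′ a≤b)
  where
  go : ∀ {b} → a ≤′ b → f a ≤ f b
  go ≤′-refl       = ≤-refl
  go (≤′-step a≤b) = ≤-trans (go a≤b) (step _)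

staircase : (ℕ → ℕ) → ℕ → List ℕ
staircase f m = concatMap (λ k → replicate (f k ∸ f (pred k)) k) (interval 1 m)

staircase-∷ʳ : ∀ f m → staircase f (suc m) ≡ staircase f m ++ replicate (f (suc m) ∸ f m) (suc m)
staircase-∷ʳ f m = begin
  concatMap step (interval 1 (suc m))                ≡⟨ cong (concatMap step) (interval-∷ʳ 1 m) ⟩
  concatMap step (interval 1 m ++ suc m ∷ [])        ≡⟨ concatMap-++ step (interval 1 m) (suc m ∷ []) ⟩
  staircase f m ++ (step (suc m) ++ [])              ≡⟨ cong (staircase f m ++_) (++-identityʳ (step (suc m))) ⟩
  staircase f m ++ step (suc m)                      ∎
  where
  open ≡-Reasoning
  step = λ k → replicate (f k ∸ f (pred k)) k

module _ {f : ℕ → ℕ} (f0≡0 : f 0 ≡ 0) (f↑ : Increasing f) where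

  length-staircase : ∀ m → length (staircase f m) ≡ f m
  length-staircase zero    = sym f0≡0
  length-staircase (suc m) = begin
    length (staircase f (suc m))                                   ≡⟨ cong length (staircase-∷ʳ f m) ⟩
    length (staircase f m ++ replicate (f (suc m) ∸ f m) (suc m))  ≡⟨ length-++ (staircase f m) ⟩
    length (staircase f m) + length (replicate (f (suc m) ∸ f m) (suc m))
                                                                   ≡⟨ cong₂ _+_ (length-staircase m) (length-replicate (f (suc m) ∸ f m)) ⟩
    f m + (f (suc m) ∸ f m)                                        ≡⟨ m+[n∸m]≡n (f↑ m) ⟩
    f (suc m)                                                      ∎
    where open ≡-Reasoning

  at-staircase : ∀ m j y → at (staircase f m) j ≡ just y → 1 ≤ y × y ≤ m × f (pred y) ≤ j × j < f y
  at-staircase zero    j y ()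
  at-staircase (suc m) j y at≡y
    with at-++-replicate (staircase f m) (f (suc m) ∸ f m) (suc m) y j
                         (trans (cong (λ w → at w j) (sym (staircase-∷ʳ f m))) at≡y)
  ... | inj₁ earlier = let 1≤y , y≤m , lo , hi = at-staircase m j y earlier in 1≤y , m≤n⇒m≤1+n y≤m , lo , hi
  ... | inj₂ (len≤j , j<len+d , refl) rewrite length-staircase m =
    s≤s z≤n , ≤-refl , len≤j , subst (j <_) (m+[n∸m]≡n (f↑ m)) j<len+d

  staircase-sorted : ∀ m j x y → at (staircase f m) j ≡ just x → at (staircase f m) (suc j) ≡ just y → x ≤ y
  staircase-sorted m j x y at≡x at≡y = ≮⇒≥ λ y<x →
    let _ , _ , fx-1≤j , _ = at-staircase m j x at≡x
        _ , _ , _ , j+1<fy = at-staircase m (suc j) y at≡y in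
    <-irrefl refl (≤-<-trans (Increasing⇒mono f↑ (pred-mono-≤ y<x)) (≤-<-trans fx-1≤j (<-trans (n<1+n j) j+1<fy)))

staircase-below : ∀ {f g} → f 0 ≡ 0 → Increasing f → g 0 ≡ 0 → Increasing g → (∀ k → g (suc k) ≤ f k) →
  ∀ m j y → at (staircase g m) j ≡ just y → ∃ λ x → at (staircase f m) j ≡ just x × x < y
staircase-below f0≡0 f↑ g0≡0 g↑ g≤f m j zero at≡0 with () ← proj₁ (at-staircase g0≡0 g↑ m j zero at≡0)
staircase-below {f} {g} f0≡0 f↑ g0≡0 g↑ g≤f m j (suc y) at≡y =
  x , at≡x , ≰⇒> λ y<x → <-irrefl refl (≤-<-trans (Increasing⇒mono f↑ (pred-mono-≤ y<x)) (≤-<-trans fx-1≤j j<fy))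
  where
  y-facts = at-staircase g0≡0 g↑ m j (suc y) at≡y
  j<fy : j < f y
  j<fy = <-≤-trans (proj₂ (proj₂ (proj₂ y-facts))) (g≤f y)
  j<length : j < length (staircase f m)
  j<length = subst (j <_) (sym (length-staircase f0≡0 f↑ m))
                   (<-≤-trans j<fy (Increasing⇒mono f↑ (≤-trans (n≤1+n y) (proj₁ (proj₂ y-facts)))))
  x = proj₁ (at-<length (staircase f m) j j<length)
  at≡x = proj₂ (at-<length (staircase f m) j j<length)
  fx-1≤j = proj₁ (proj₂ (proj₂ (at-staircase f0≡0 f↑ m j x at≡x)))

private
  countᵇ-staircase : ∀ f k m →
    countᵇ (k ≡ᵇ_) (staircase f m) ≡ ∑ (λ k′ → (f k′ ∸ f (pred k′)) * indicator (k ≡ᵇ k′)) (interval 1 m)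
  countᵇ-staircase f k m = trans (countᵇ-concatMap (k ≡ᵇ_) _ (interval 1 m))
    (∑-congᴬ (interval 1 m) (All.universal (λ k′ → countᵇ-replicate (k ≡ᵇ_) (f k′ ∸ f (pred k′)) k′) _))

countᵇ-staircase-∈ : ∀ f {k m} → 1 ≤ k → k ≤ m → countᵇ (k ≡ᵇ_) (staircase f m) ≡ f k ∸ f (pred k)
countᵇ-staircase-∈ f {k} {m} 1≤k k≤m =
  trans (countᵇ-staircase f k m) (∑-delta-∈ (λ k′ → f k′ ∸ f (pred k′)) k 1 m 1≤k (s≤s k≤m))

countᵇ-staircase-∉ : ∀ f {k m} → All (k ≢_) (interval 1 m) → countᵇ (k ≡ᵇ_) (staircase f m) ≡ 0
countᵇ-staircase-∉ f {k} {m} k∉ =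
  trans (countᵇ-staircase f k m) (∑-delta-∉ (λ k′ → f k′ ∸ f (pred k′)) k (interval 1 m) k∉)

conjugate : (ℕ → ℕ) → ℕ → List ℕ
conjugate w zero    = []
conjugate w (suc R) = replicate (w (suc R) ∸ w (suc (suc R))) (suc R) ++ conjugate w R

private
  linked-replicate-++ : ∀ d {x ys} → All (_≤ x) ys → Linked (λ a b → b ≤ a) ys →
    Linked (λ a b → b ≤ a) (replicate d x ++ ys)
  linked-replicate-++ zero          _           ys↓ = ys↓
  linked-replicate-++ (suc zero)    {ys = []}    _           _   = [-]
  linked-replicate-++ (suc zero)    {ys = _ ∷ _} (y≤x ∷ _)  ys↓ = y≤x ∷ ys↓
  linked-replicate-++ (suc (suc d)) ys≤x ys↓ = ≤-refl ∷ linked-replicate-++ (suc d) ys≤x ys↓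

  conjugate-≤ : ∀ w R → All (_≤ R) (conjugate w R)
  conjugate-≤ w zero    = []
  conjugate-≤ w (suc R) = ++⁺ (replicate⁺ _ ≤-refl) (All.map m≤n⇒m≤1+n (conjugate-≤ w R))

conjugate-IsPartition : ∀ w R → IsPartition (conjugate w R)
conjugate-IsPartition w R = sorted R , positive R
  where
  sorted : ∀ R → Linked (λ a b → b ≤ a) (conjugate w R)
  sorted zero    = []
  sorted (suc R) = linked-replicate-++ _ (All.map m≤n⇒m≤1+n (conjugate-≤ w R)) (sorted R)
  positive : ∀ R → All (0 <_) (conjugate w R)
  positive zero    = []
  positive (suc R) = ++⁺ (replicate⁺ _ z<s) (positive R)

private
  ∸-telescope : ∀ {a b c} → c ≤ b → b ≤ a → (b ∸ c) + (a ∸ b) ≡ a ∸ c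
  ∸-telescope {a} {b} {c} c≤b b≤a = begin
    (b ∸ c) + (a ∸ b)   ≡⟨ +-comm (b ∸ c) _ ⟩
    (a ∸ b) + (b ∸ c)   ≡⟨ +-∸-assoc (a ∸ b) c≤b ⟨
    (a ∸ b) + b ∸ c     ≡⟨ cong (_∸ c) (m∸n+n≡m b≤a) ⟩
    a ∸ c               ∎
    where open ≡-Reasoning

module _ {w : ℕ → ℕ} (w↓ : ∀ R → 1 ≤ R → w (suc R) ≤ w R) where

  antitone : ∀ {a b} → 1 ≤ a → a ≤ b → w b ≤ w a
  antitone {a} 1≤a a≤b = go (≤⇒≤′ a≤b)
    where
    go : ∀ {b} → a ≤′ b → w b ≤ w a
    go ≤′-refl       = ≤-refl
    go (≤′-step a≤b) = ≤-trans (w↓ _ (≤-trans 1≤a (≤′⇒≤ a≤b))) (go a≤b)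

  conj-conjugate : ∀ R r → 1 ≤ r → conj (conjugate w R) r ≡ w r ∸ w (suc R)
  conj-conjugate R r 1≤r = trans (length-filterᵇ (r ≤ᵇ_) (conjugate w R)) (count R)
    where
    count : ∀ R → countᵇ (r ≤ᵇ_) (conjugate w R) ≡ w r ∸ w (suc R)
    count zero    = sym (m≤n⇒m∸n≡0 (antitone ≤-refl 1≤r))
    count (suc R) = begin
      countᵇ (r ≤ᵇ_) (replicate d (suc R) ++ conjugate w R)   ≡⟨ countᵇ-++ (r ≤ᵇ_) (replicate d (suc R)) _ ⟩
      countᵇ (r ≤ᵇ_) (replicate d (suc R)) + countᵇ (r ≤ᵇ_) (conjugate w R)
                                                              ≡⟨ cong₂ _+_ (countᵇ-replicate (r ≤ᵇ_) d (suc R)) (count R) ⟩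
      d * indicator (r ≤ᵇ suc R) + (w r ∸ w (suc R))          ≡⟨ top-layer ⟩
      w r ∸ w (suc (suc R))                                   ∎
      where
      open ≡-Reasoning
      d = w (suc R) ∸ w (suc (suc R))
      top-layer : d * indicator (r ≤ᵇ suc R) + (w r ∸ w (suc R)) ≡ w r ∸ w (suc (suc R))
      top-layer with r ≤? suc R
      ... | yes r≤1+R rewrite ≤ᵇ≡true r≤1+R | *-identityʳ d =
        ∸-telescope (w↓ (suc R) (s≤s z≤n)) (antitone 1≤r r≤1+R)
      ... | no r≰1+R rewrite ≤ᵇ≡false r≰1+R | *-zeroʳ d
                           | m≤n⇒m∸n≡0 (antitone (s≤s z≤n) (<⇒≤ (≰⇒> r≰1+R))) =
        sym (m≤n⇒m∸n≡0 (antitone (s≤s z≤n) (≰⇒> r≰1+R)))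

-- The Ferrari–Martin pairing under dominance

firstGeq-nothing : ∀ j xs → firstGeq j xs ≡ nothing → countᵇ (j ≤ᵇ_) xs ≡ 0
firstGeq-nothing j []       _ = refl
firstGeq-nothing j (x ∷ xs) e with j ≤ᵇ x
... | false = firstGeq-nothing j xs e

firstGeq-≥ : ∀ {j x} xs → firstGeq j xs ≡ just x → j ≤ x
firstGeq-≥ {j} (y ∷ xs) e with j ≤ᵇ y in j≤ᵇy
... | true  with refl ← e = ≤ᵇ⇒≤ j y (T⇐≡true j≤ᵇy)
... | false = firstGeq-≥ xs e

firstGeq-gap : ∀ {j x a} xs → AllPairs _<_ xs → firstGeq j xs ≡ just x → j ≤ a → a ≤ x →
  countᵇ (a ≤ᵇ_) xs ≡ countᵇ (j ≤ᵇ_) xs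
firstGeq-gap {j} {x} {a} (y ∷ xs) (y<xs ∷ xs↑) e j≤a a≤x with j ≤? y
... | no j≰y rewrite ≤ᵇ≡false j≰y | ≤ᵇ≡false (λ a≤y → j≰y (≤-trans j≤a a≤y)) =
  firstGeq-gap xs xs↑ e j≤a a≤x
... | yes j≤y rewrite ≤ᵇ≡true j≤y with refl ← e
  rewrite ≤ᵇ≡true a≤x
  = cong suc (trans (countᵇ-all _ xs (All.map (λ y<z → ≤ᵇ≡true (≤-trans a≤x (<⇒≤ y<z))) y<xs))
                    (sym (countᵇ-all _ xs (All.map (λ y<z → ≤ᵇ≡true (≤-trans j≤y (<⇒≤ y<z))) y<xs))))

countᵇ-removeℕ : ∀ {j x} (p : ℕ → Bool) xs → AllPairs _<_ xs → firstGeq j xs ≡ just x →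
  countᵇ p xs ≡ countᵇ p (removeℕ x xs) + indicator (p x)
countᵇ-removeℕ {j} {x} p (y ∷ xs) (y<xs ∷ xs↑) e with j ≤? y
... | no j≰y rewrite ≤ᵇ≡false j≰y
                   | ≡ᵇ-≢ {y} {x} (λ y≡x → j≰y (subst (j ≤_) (sym y≡x) (firstGeq-≥ xs e))) =
  trans (cong (indicator (p y) +_) (countᵇ-removeℕ p xs xs↑ e)) (sym (+-assoc (indicator (p y)) _ _))
... | yes j≤y rewrite ≤ᵇ≡true j≤y with refl ← e rewrite ≡ᵇ-refl y =
  trans (+-comm (indicator (p y)) _)
        (cong (_+ indicator (p y)) (sym (trans (countᵇ-filterᵇ p _ xs)
          (countᵇ-congᴬ xs (All.map (λ y<z → cong (_∧ p _) (cong not (≡ᵇ-≢ (>⇒≢ y<z)))) y<xs)))))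

Hall : List (ℕ × ℕ) → List ℕ → Set
Hall demand supply = ∀ a → countᵇ (λ p → a ≤ᵇ proj₁ p) demand ≤ countᵇ (a ≤ᵇ_) supply

module _ {j ℓ cc : ℕ} (rest : List (ℕ × ℕ)) (avail : List ℕ) (avail↑ : AllPairs _<_ avail)
         (fg : firstGeq j avail ≡ just cc) (hall : Hall ((j , ℓ) ∷ rest) avail) where

  private
    Rest Avail Avail′ : ℕ → ℕ
    Rest a = countᵇ (λ p → a ≤ᵇ proj₁ p) rest
    Avail a = countᵇ (a ≤ᵇ_) avail
    Avail′ a = countᵇ (a ≤ᵇ_) (removeℕ cc avail)

    j≤cc : j ≤ cc
    j≤cc = firstGeq-≥ avail fg

    hall-after : ∀ a → indicator (a ≤ᵇ j) + Rest a ≤ Avail′ a + indicator (a ≤ᵇ cc)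
    hall-after a = subst (_ ≤_) (countᵇ-removeℕ (a ≤ᵇ_) avail avail↑ fg) (hall a)

  Hall-∷ : Hall rest (removeℕ cc avail)
  Hall-∷ a with a ≤? j | a ≤? cc
  ... | yes a≤j | _ = s≤s⁻¹ (subst₂ _≤_ (cong (λ b → indicator b + Rest a) (≤ᵇ≡true a≤j))
                                        (trans (cong (λ b → Avail′ a + indicator b) (≤ᵇ≡true (≤-trans a≤j j≤cc)))
                                               (+-comm (Avail′ a) 1))
                                        (hall-after a))
  ... | no a≰j | no a≰cc = begin
    Rest a                           ≤⟨ m≤n+m (Rest a) _ ⟩
    indicator (a ≤ᵇ j) + Rest a      ≤⟨ hall-after a ⟩
    Avail′ a + indicator (a ≤ᵇ cc)   ≡⟨ cong (λ b → Avail′ a + indicator b) (≤ᵇ≡false a≰cc) ⟩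
    Avail′ a + 0                     ≡⟨ +-identityʳ (Avail′ a) ⟩
    Avail′ a                         ∎
    where open ≤-Reasoning
  ... | no a≰j | yes a≤cc = s≤s⁻¹ (begin
    suc (Rest a)                     ≤⟨ s≤s (countᵇ-mono rest λ p a≤p → ≤ᵇ≡true (≤-trans j≤a (≤ᵇ⇒≤ a _ (T⇐≡true a≤p)))) ⟩
    suc (Rest j)                     ≡⟨ cong (λ b → indicator b + Rest j) (≤ᵇ≡true (≤-refl {j})) ⟨
    indicator (j ≤ᵇ j) + Rest j      ≤⟨ hall j ⟩
    Avail j                          ≡⟨ firstGeq-gap avail avail↑ fg j≤a a≤cc ⟨
    Avail a                          ≡⟨ countᵇ-removeℕ (a ≤ᵇ_) avail avail↑ fg ⟩
    Avail′ a + indicator (a ≤ᵇ cc)   ≡⟨ cong (λ b → Avail′ a + indicator b) (≤ᵇ≡true a≤cc) ⟩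
    Avail′ a + 1                     ≡⟨ +-comm (Avail′ a) 1 ⟩
    suc (Avail′ a)                   ∎)
    where
    open ≤-Reasoning
    j≤a = <⇒≤ (≰⇒> a≰j)

-- Under Hall's condition on final segments each ball of row r finds an available ball of
-- row r − 1 weakly to its right, and the condition survives the pairing.
pairRow-no-wrap : ∀ r order avail → AllPairs _<_ avail → Hall order avail → proj₁ (pairRow r avail order) ≡ 0
pairRow-no-wrap r []               avail avail↑ hall = refl
pairRow-no-wrap r ((j , ℓ) ∷ rest) avail avail↑ hall with firstGeq j avail in fg
... | nothing = ⊥-elim (n≮0 (subst₂ _≤_ (cong (λ b → indicator b + countᵇ (λ p → j ≤ᵇ proj₁ p) rest) (≤ᵇ≡true (≤-refl {j})))
                                        (firstGeq-nothing j avail fg) (hall j)))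
... | just cc =
  pairRow-no-wrap r rest (removeℕ cc avail) (AllPairs.filter⁺ _ avail↑) (Hall-∷ {ℓ = ℓ} rest avail avail↑ fg hall)

countᵇ-group : ∀ {A : Set} (q : A → Bool) (key : A → ℕ) (xs : List A) (ks : List ℕ) → (∀ m → countᵇ (m ≡ᵇ_) ks ≤ 1) →
  countᵇ q (concatMap (λ k → filterᵇ (λ x → key x ≡ᵇ k) xs) ks) ≤ countᵇ q xs
countᵇ-group q key xs ks ks-unique = begin
  countᵇ q (concatMap (λ k → filterᵇ (λ x → key x ≡ᵇ k) xs) ks) ≡⟨ countᵇ-concatMap q _ ks ⟩
  ∑ (λ k → countᵇ q (filterᵇ (λ x → key x ≡ᵇ k) xs)) ks         ≡⟨ ∑-congᴬ ks (All.universal (λ k → countᵇ-filterᵇ q _ xs) ks) ⟩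
  ∑ (λ k → countᵇ (λ x → (key x ≡ᵇ k) ∧ q x) xs) ks            ≤⟨ by-elements xs ⟩
  countᵇ q xs                                                  ∎
  where
  open ≤-Reasoning
  by-elements : ∀ xs → ∑ (λ k → countᵇ (λ x → (key x ≡ᵇ k) ∧ q x) xs) ks ≤ countᵇ q xs
  by-elements []       = ≤-reflexive (∑-zero _ ks (All.universal (λ _ → refl) ks))
  by-elements (x ∷ xs) = begin
    ∑ (λ k → indicator ((key x ≡ᵇ k) ∧ q x) + countᵇ (λ y → (key y ≡ᵇ k) ∧ q y) xs) ks
      ≡⟨ ∑-+ (λ k → indicator ((key x ≡ᵇ k) ∧ q x)) _ ks ⟩
    countᵇ (λ k → (key x ≡ᵇ k) ∧ q x) ks + ∑ (λ k → countᵇ (λ y → (key y ≡ᵇ k) ∧ q y) xs) ks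
      ≤⟨ +-mono-≤ (at-most-once (q x)) (by-elements xs) ⟩
    indicator (q x) + countᵇ q xs ∎
    where
    at-most-once : ∀ b → countᵇ (λ k → (key x ≡ᵇ k) ∧ b) ks ≤ indicator b
    at-most-once true  = ≤-trans (≤-reflexive (countᵇ-cong ks λ k → ∧-identityʳ _)) (ks-unique (key x))
    at-most-once false = ≤-reflexive (countᵇ-none _ ks (All.universal (λ k → ∧-zeroʳ _) ks))

countᵇ-≡ᵇ-unique : ∀ {xs} → AllPairs _≢_ xs → ∀ m → countᵇ (m ≡ᵇ_) xs ≤ 1
countᵇ-≡ᵇ-unique []                  m = z≤n
countᵇ-≡ᵇ-unique {x ∷ xs} (x∉xs ∷ xs!) m with m ≟ x
... | yes refl rewrite ≡ᵇ-refl m = s≤s (≤-reflexive (countᵇ-none _ xs (All.map ≡ᵇ-≢ x∉xs)))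
... | no  m≢x  rewrite ≡ᵇ-≢ m≢x  = countᵇ-≡ᵇ-unique xs! m

private
  ≤pred⇒< : ∀ {x a} → 1 ≤ x → x ≤ pred a → x < a
  ≤pred⇒< {a = zero}  (s≤s _) ()
  ≤pred⇒< {a = suc a} _       x≤a = s≤s x≤a

  ≤suc-pred : ∀ a → a ≤ suc (pred a)
  ≤suc-pred zero    = z≤n
  ≤suc-pred (suc a) = ≤-refl

  from-≤ : ∀ (P : ℕ → Bool) a {x} → a ≤ x → P x ∧ (a ≤ᵇ x) ≡ P x
  from-≤ P a {x} a≤x rewrite ≤ᵇ≡true a≤x = ∧-identityʳ (P x)

  from-≰ : ∀ (P : ℕ → Bool) a {x} → a ≰ x → P x ∧ (a ≤ᵇ x) ≡ false
  from-≰ P a {x} a≰x rewrite ≤ᵇ≡false a≰x = ∧-zeroʳ (P x)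

countᵇ-final-segment : ∀ n a → ∃ λ a′ → a′ ≤ suc n × ∀ P →
  countᵇ (a ≤ᵇ_) (filterᵇ P (one-to n)) ≡ countᵇ P (interval a′ (suc n ∸ a′))
countᵇ-final-segment n a with pred a ≤? n
... | yes k≤n = suc k , s≤s k≤n , λ P → begin
  countᵇ (a ≤ᵇ_) (filterᵇ P (one-to n))                   ≡⟨ countᵇ-filterᵇ (a ≤ᵇ_) P (one-to n) ⟩
  countᵇ (P ∧≥a) (one-to n)                               ≡⟨ cong (countᵇ (P ∧≥a)) (trans (one-to≡interval n) split) ⟩
  countᵇ (P ∧≥a) (interval 1 k ++ interval (suc k) (n ∸ k)) ≡⟨ countᵇ-++ (P ∧≥a) (interval 1 k) _ ⟩
  countᵇ (P ∧≥a) (interval 1 k) + countᵇ (P ∧≥a) (interval (suc k) (n ∸ k))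
    ≡⟨ cong₂ _+_ (countᵇ-none (P ∧≥a) _ (interval-All 1 k λ x 1≤x x<1+k → from-≰ P a (<⇒≱ (≤pred⇒< 1≤x (s≤s⁻¹ x<1+k)))))
                 (countᵇ-congᴬ _ (interval-All (suc k) (n ∸ k) λ x k<x _ → from-≤ P a (≤-trans (≤suc-pred a) k<x))) ⟩
  countᵇ P (interval (suc k) (n ∸ k))                     ∎
  where
  open ≡-Reasoning
  k = pred a
  _∧≥a : (ℕ → Bool) → ℕ → Bool
  (P ∧≥a) x = P x ∧ (a ≤ᵇ x)
  split : interval 1 n ≡ interval 1 k ++ interval (suc k) (n ∸ k)
  split = trans (cong (interval 1) (sym (m+[n∸m]≡n k≤n))) (interval-++ 1 k (n ∸ k))
... | no k≰n = suc n , ≤-refl , λ P → begin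
  countᵇ (a ≤ᵇ_) (filterᵇ P (one-to n))         ≡⟨ countᵇ-filterᵇ (a ≤ᵇ_) P (one-to n) ⟩
  countᵇ (λ x → P x ∧ (a ≤ᵇ x)) (one-to n)       ≡⟨ countᵇ-none _ _ (subst (All _) (sym (one-to≡interval n)) (beyond P)) ⟩
  0                                             ≡⟨ cong (λ m → countᵇ P (interval (suc n) m)) (n∸n≡0 n) ⟨
  countᵇ P (interval (suc n) (n ∸ n))           ∎
  where
  open ≡-Reasoning
  beyond : ∀ P → All (λ x → P x ∧ (a ≤ᵇ x) ≡ false) (interval 1 n)
  beyond P = interval-All 1 n λ x _ x<1+n →
    from-≰ P a λ a≤x → k≰n (≤-trans (pred-mono-≤ a≤x) (≤-trans pred[n]≤n (s≤s⁻¹ x<1+n)))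

Dominated⇒ballCols : ∀ {L n} (M : Grid L n) i → Dominated n (ball M (suc i)) (ball M i) →
  ∀ a → countᵇ (a ≤ᵇ_) (ballCols M (suc i)) ≤ countᵇ (a ≤ᵇ_) (ballCols M i)
Dominated⇒ballCols {n = n} M i dom a with countᵇ-final-segment n a
... | a′ , a′≤1+n , from-a = subst₂ _≤_ (sym (from-a (ball M (suc i)))) (sym (from-a (ball M i)))
                                         (dom a′ (suc n ∸ a′) (m+[n∸m]≡n a′≤1+n))

ballCols-increasing : ∀ {L n} (M : Grid L n) r → AllPairs _<_ (ballCols M r)
ballCols-increasing {n = n} M r =
  AllPairs.filter⁺ _ (AllPairs.map⁺ (AllPairs.applyUpTo⁺₁ (λ x → x) n λ i<j _ → s≤s i<j))

labels-unique : ∀ L → AllPairs _≢_ (map suc (downFrom L))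
labels-unique L = AllPairs.map⁺ (AllPairs.applyDownFrom⁺₁ (λ x → x) L λ j<i _ → >⇒≢ (s≤s j<i))

private
  map-proj₁-pairs : ∀ {A : Set} (g : ℕ → A) xs → map proj₁ (map (λ x → x , g x) xs) ≡ xs
  map-proj₁-pairs g xs = trans (sym (map-∘ xs)) (map-id xs)

module _ {L n : ℕ} (M : Grid L n) where

  fmGo≡0 : ∀ k lab → map proj₁ lab ≡ ballCols M (suc k) →
    (∀ i → 1 ≤ i → i ≤ k → ∀ a → countᵇ (a ≤ᵇ_) (ballCols M (suc i)) ≤ countᵇ (a ≤ᵇ_) (ballCols M i)) →
    fmGo M k lab ≡ 0
  fmGo≡0 zero    lab _    _   = refl
  fmGo≡0 (suc k) lab cols dom =
    cong₂ _+_ no-wrap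
              (fmGo≡0 k _ (map-proj₁-pairs _ (ballCols M (suc k))) λ i 1≤i i≤k → dom i 1≤i (m≤n⇒m≤1+n i≤k))
    where
    open ≤-Reasoning
    labels = map suc (downFrom L)
    order = concatMap (λ ℓ → filterᵇ (λ p → proj₂ p ≡ᵇ ℓ) lab) labels
    no-wrap : proj₁ (pairRow (suc (suc k)) (ballCols M (suc k)) order) ≡ 0
    no-wrap = pairRow-no-wrap _ order _ (ballCols-increasing M (suc k)) λ a → begin
      countᵇ (λ p → a ≤ᵇ proj₁ p) order            ≤⟨ countᵇ-group _ proj₂ lab labels (countᵇ-≡ᵇ-unique (labels-unique L)) ⟩
      countᵇ (λ p → a ≤ᵇ proj₁ p) lab              ≡⟨ countᵇ-map (a ≤ᵇ_) proj₁ lab ⟨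
      countᵇ (a ≤ᵇ_) (map proj₁ lab)                ≡⟨ cong (countᵇ (a ≤ᵇ_)) cols ⟩
      countᵇ (a ≤ᵇ_) (ballCols M (suc (suc k)))     ≤⟨ dom (suc k) (s≤s z≤n) ≤-refl a ⟩
      countᵇ (a ≤ᵇ_) (ballCols M (suc k))           ∎

maj≡0 : ∀ {L n} (M : Grid L n) → (∀ i → 1 ≤ i → suc i ≤ L → Dominated n (ball M (suc i)) (ball M i)) → maj M ≡ 0
maj≡0 {zero}  M _   = refl
maj≡0 {suc L} M dom = fmGo≡0 M L _ (map-proj₁-pairs _ (ballCols M (suc L)))
                        λ i 1≤i i≤L → Dominated⇒ballCols M i (dom i 1≤i (s≤s i≤L))

-- The recording tableau

entry-at : ∀ T r j {row} → at T r ≡ just row → entry T r j ≡ at row j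
entry-at T r j e with at T r
entry-at T r j refl | just _ = refl

entry-nothing : ∀ T r j → at T r ≡ nothing → entry T r j ≡ nothing
entry-nothing T r j e with at T r
entry-nothing T r j refl | nothing = refl

module Recording {L n : ℕ} (B : Grid L n) where

  open Collapse B

  size-row0 : ∀ G → size G 0 ≡ 0
  size-row0 G = countᵇ-none _ (interval 1 n) (All.universal (ball-row0 G) _)

  size-row> : ∀ G R → L < R → size G R ≡ 0
  size-row> G R L<R = countᵇ-none _ (interval 1 n) (All.universal (λ J → ball-row> G R J L<R) _)

  c-within : ∀ {k r} → r ≤ k → c B k r ≡ size (stage k B) r
  c-within {k} {r} r≤k rewrite ≤ᵇ≡true r≤k = rowCount≡countᵇ (stage k B) r

  c-beyond : ∀ {k r} → k < r → c B k r ≡ 0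
  c-beyond {k} {r} k<r rewrite ≤ᵇ≡false (<⇒≱ k<r) = refl

  c-row0 : ∀ k → c B k 0 ≡ 0
  c-row0 k = trans (c-within {k} z≤n) (size-row0 (stage k B))

  c-stage0 : ∀ r → c B 0 r ≡ 0
  c-stage0 zero    = c-row0 0
  c-stage0 (suc r) = c-beyond {0} {suc r} z<s

  c-row> : ∀ k {r} → L < r → c B k r ≡ 0
  c-row> k {r} L<r with r ≤? k
  ... | yes r≤k = trans (c-within r≤k) (size-row> (stage k B) r L<r)
  ... | no  r≰k = c-beyond (≰⇒> r≰k)

  c-increasing : ∀ r → Increasing (λ k → c B k r)
  c-increasing zero    k = ≤-reflexive (trans (c-row0 k) (sym (c-row0 (suc k))))
  c-increasing (suc r) k with suc r ≤? k
  ... | yes r<k = subst₂ _≤_ (sym (c-within r<k)) (sym (c-within (m≤n⇒m≤1+n r<k)))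
                             (size-mono k (suc r) (s≤s z≤n) r<k)
  ... | no  r≮k = ≤-trans (≤-reflexive (c-beyond (≰⇒> r≮k))) z≤n

  c-strip : ∀ R → 1 ≤ R → ∀ k → c B (suc k) (suc R) ≤ c B k R
  c-strip R 1≤R k with R ≤? k
  ... | yes R≤k = subst₂ _≤_ (sym (c-within (s≤s R≤k))) (sym (c-within R≤k)) (size-strip k R 1≤R R≤k)
  ... | no  R≰k = ≤-trans (≤-reflexive (c-beyond (s≤s (≰⇒> R≰k)))) z≤n

  row : ℕ → List ℕ
  row r = staircase (λ k → c B k r) L

  ρQ≡ : ρQ B ≡ map row (interval 1 L)
  ρQ≡ = cong₂ (λ ks rs → map (λ r → concatMap (λ k → replicate (c B k r ∸ c B (pred k) r) k) ks) rs)
              (one-to≡interval L) (one-to≡interval L)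

  at-ρQ : ∀ {r} → r < L → at (ρQ B) r ≡ just (row (suc r))
  at-ρQ {r} r<L = trans (cong (λ T → at T r) ρQ≡) (at-map-interval row 1 L r r<L)

  at-ρQ-≥ : ∀ {r} → L ≤ r → at (ρQ B) r ≡ nothing
  at-ρQ-≥ {r} L≤r = trans (cong (λ T → at T r) ρQ≡) (at-map-interval-≥ row 1 L r L≤r)

  entry-ρQ : ∀ {r j x} → entry (ρQ B) r j ≡ just x → r < L × at (row (suc r)) j ≡ just x
  entry-ρQ {r} {j} e with r <? L
  ... | yes r<L = r<L , trans (sym (entry-at (ρQ B) r j (at-ρQ r<L))) e
  ... | no  r≮L with () ← trans (sym (entry-nothing (ρQ B) r j (at-ρQ-≥ (≮⇒≥ r≮L)))) e

  ρQ-IsSSYT : IsSSYT (ρQ B)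
  ρQ-IsSSYT = rows-sorted , columns-strict
    where
    rows-sorted : ∀ r j x y → entry (ρQ B) r j ≡ just x → entry (ρQ B) r (suc j) ≡ just y → x ≤ y
    rows-sorted r j x y ex ey =
      staircase-sorted (c-stage0 (suc r)) (c-increasing (suc r)) L j x y (proj₂ (entry-ρQ ex)) (proj₂ (entry-ρQ ey))
    columns-strict : ∀ r j y → entry (ρQ B) (suc r) j ≡ just y → ∃ λ x → entry (ρQ B) r j ≡ just x × x < y
    columns-strict r j y ey =
      let r+1<L , at≡y = entry-ρQ ey
          x , at≡x , x<y = staircase-below (c-stage0 (suc r)) (c-increasing (suc r))
                                           (c-stage0 (suc (suc r))) (c-increasing (suc (suc r)))
                                           (c-strip (suc r) (s≤s z≤n)) L j y at≡y
      in x , trans (entry-at (ρQ B) r j (at-ρQ (<-trans (n<1+n r) r+1<L))) at≡x , x<y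

  rowLen-ρQ : ∀ r → rowLen (ρQ B) r ≡ size (ρN B) (suc r)
  rowLen-ρQ r with r <? L
  ... | yes r<L rewrite at-ρQ r<L = trans (length-staircase (c-stage0 (suc r)) (c-increasing (suc r)) L) (c-within r<L)
  ... | no  r≮L rewrite at-ρQ-≥ (≮⇒≥ r≮L) = sym (size-row> (ρN B) (suc r) (s≤s (≮⇒≥ r≮L)))

  ∑-c : ∀ k → ∑ (c B k) (interval 1 L) ≡ ∑ (size (stage k B)) (interval 1 k)
  ∑-c k = begin
    ∑ (c B k) (interval 1 L)                 ≡⟨ ∑-interval-vanishing (c B k) L k (interval-All (suc L) k λ r L<r _ → c-row> k L<r) ⟨
    ∑ (c B k) (interval 1 (L + k))           ≡⟨ cong (λ m → ∑ (c B k) (interval 1 m)) (+-comm L k) ⟩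
    ∑ (c B k) (interval 1 (k + L))           ≡⟨ ∑-interval-vanishing (c B k) k L (interval-All (suc k) L λ r k<r _ → c-beyond k<r) ⟩
    ∑ (c B k) (interval 1 k)                 ≡⟨ ∑-congᴬ (interval 1 k) (interval-All 1 k λ r _ r<1+k → c-within (s≤s⁻¹ r<1+k)) ⟩
    ∑ (size (stage k B)) (interval 1 k)      ∎
    where open ≡-Reasoning

  countEntries-ρQ : ∀ k → countEntries k (ρQ B) ≡ ∑ (λ r → countᵇ (k ≡ᵇ_) (row r)) (interval 1 L)
  countEntries-ρQ k = begin
    countEntries k (ρQ B)                                        ≡⟨ cong (countEntries k) ρQ≡ ⟩
    countEntries k (map row (interval 1 L))                      ≡⟨ cong sum (map-∘ (interval 1 L)) ⟨
    sum (map (λ r → length (filterᵇ (k ≡ᵇ_) (row r))) (interval 1 L))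
                                                                 ≡⟨ sum-map _ (interval 1 L) ⟩
    ∑ (λ r → length (filterᵇ (k ≡ᵇ_) (row r))) (interval 1 L)     ≡⟨ ∑-congᴬ (interval 1 L) (All.universal (λ r → length-filterᵇ (k ≡ᵇ_) (row r)) _) ⟩
    ∑ (λ r → countᵇ (k ≡ᵇ_) (row r)) (interval 1 L)               ∎
    where open ≡-Reasoning

  countEntries-∉ : ∀ {k} → All (k ≢_) (interval 1 L) → countEntries k (ρQ B) ≡ 0
  countEntries-∉ {k} k∉ =
    trans (countEntries-ρQ k)
          (∑-zero _ (interval 1 L) (All.universal (λ r → countᵇ-staircase-∉ (λ k → c B k r) k∉) _))

  content : ∀ k → countEntries k (ρQ B) ≡ rowCount B k
  content zero = trans (countEntries-∉ (interval-All 1 L λ _ 1≤x _ 0≡x → <-irrefl 0≡x 1≤x))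
                       (sym (trans (rowCount≡countᵇ B 0) (size-row0 B)))
  content (suc k) with suc k ≤? L
  ... | no k≰L = trans (countEntries-∉ (interval-All 1 L λ x _ x<1+L k≡x → k≰L (subst (_≤ L) (sym k≡x) (s≤s⁻¹ x<1+L))))
                       (sym (trans (rowCount≡countᵇ B (suc k)) (size-row> B (suc k) (≰⇒> k≰L))))
  ... | yes k≤L = begin
    countEntries (suc k) (ρQ B)                                ≡⟨ countEntries-ρQ (suc k) ⟩
    ∑ (λ r → countᵇ (suc k ≡ᵇ_) (row r)) (interval 1 L)        ≡⟨ ∑-congᴬ (interval 1 L) (All.universal (λ r →
                                                                    countᵇ-staircase-∈ (λ k → c B k r) (s≤s z≤n) k≤L) _) ⟩
    ∑ (λ r → c B (suc k) r ∸ c B k r) (interval 1 L)           ≡⟨ ∑-∸ (c B (suc k)) (c B k) (interval 1 L) (λ r → c-increasing r k) ⟩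
    ∑ (c B (suc k)) (interval 1 L) ∸ ∑ (c B k) (interval 1 L)  ≡⟨ cong₂ _∸_ (trans (∑-c (suc k)) (size-conserved k)) (∑-c k) ⟩
    total k + size B (suc k) ∸ total k                         ≡⟨ m+n∸m≡n (total k) _ ⟩
    size B (suc k)                                             ≡⟨ rowCount≡countᵇ B (suc k) ⟨
    rowCount B (suc k)                                         ∎
    where
    open ≡-Reasoning
    total = λ k → ∑ (size (stage k B)) (interval 1 k)

  ρN-rows-decrease : ∀ R → 1 ≤ R → size (ρN B) (suc R) ≤ size (ρN B) R
  ρN-rows-decrease R 1≤R with suc R ≤? L
  ... | yes R<L = Dominated⇒≤ (Collapsed.dominated (collapsed L) R 1≤R R<L)
  ... | no  R≮L = ≤-trans (≤-reflexive (size-row> (ρN B) (suc R) (≰⇒> R≮L))) z≤n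

proposition4p8 : (L n : ℕ) (B : Grid L n) →
    -- ρ_Q(B) is well defined: the row counts c^{(k)}_r never decrease in k
    (∀ k r → c B k r ≤ c B (Data.Nat.suc k) r) ×
    ∃ λ (μ : List ℕ) → IsPartition μ × InMLQ₀ μ (ρN B) ×
      IsSSYT (ρQ B) × HasShape (ρQ B) μ ×
      (∀ k → countEntries k (ρQ B) ≡ rowCount B k)
proposition4p8 L n B =
  (λ k r → c-increasing r k) ,
  μ , conjugate-IsPartition w L ,
  (ρN-IsMLQ , maj≡0 (ρN B) (Collapsed.dominated (collapsed L))) ,
  ρQ-IsSSYT , ρQ-shape , content
  where
  open Collapse B
  open Recording B
  w = size (ρN B)
  μ = conjugate w L
  conj-μ : ∀ r → 1 ≤ r → conj μ r ≡ w r
  conj-μ r 1≤r = trans (conj-conjugate ρN-rows-decrease L r 1≤r) (cong (w r ∸_) (size-row> (ρN B) (suc L) ≤-refl))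
  ρN-IsMLQ : IsMLQ μ (ρN B)
  ρN-IsMLQ r 1≤r = trans (rowCount≡countᵇ (ρN B) r) (sym (conj-μ r 1≤r))
  ρQ-shape : HasShape (ρQ B) μ
  ρQ-shape r = trans (rowLen-ρQ r) (sym (conj-μ (suc r) (s≤s z≤n)))
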